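{- Algorithm $\mathcal{C}$ is optimal. That is, for any $n\ge1$, $q=\lfloor n/3\rfloor$, and any preference order $\sigma\in\{\pm1\}^n$ with $h=\max\{\mathrm{h}(\sigma),\mathrm{h}(-\sigma)\}$, \[ \nu_{\max}(\sigma)=b(\beta_C(\sigma))=\min\{q,\ \lfloor (n-h)/2\rfloor\}. \]
   Context: Napkin problem: a circular table has $n$ seats labelled $1,\dots,n$ (mod $n$), seat $i+1$ immediately to the right of seat $i$; napkin $N_i$ lies between seats $i$ and $i+1$, so the diner in seat $i$ has left napkin $N_{i-1}$ and right napkin $N_i$. Diners $1,\dots,n$ are seated in the order $1,\dots,n$; $\sigma_j=+1$ (resp. $-1$) means Diner $j$ prefers the right (resp. left) napkin. A seated diner takes their preferred napkin if unclaimed, else the other adjacent napkin if unclaimed, else none (napkinless). A seating order is a permutation $w$ of $\{1,\dots,n\}$ with $w_1=1$ ($w_i=j$: Diner $j$ in Seat $i$); $\nu(w,\sigma)$ is the number of napkinless diners and $\nu_{\max}(\sigma)=\max_w\nu(w,\sigma)$. Drift: $\mathrm{h}(\sigma):=\max\left(\{0\}\cup\{\sum_{j=1}^{i}\sigma_j:1\le i\le n\}\right)$; $-\sigma$ is $\sigma$ with all signs flipped. Algorithm $\mathcal{C}$: write $n=3q+r$. For $1\le j\le q$, bench $B_j$ consists of seats $3j-2$ (leftmost), $3j-1$ (centre), $3j$ (rightmost); seats $3q+1,\dots,n$ are remainder seats. At any stage a bench $B_j$ is primed if its leftmost and rightmost seats are assigned and its centre is not; each unassigned remainder seat also counts as a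 primed bench, ordered after $B_1,\dots,B_q$, left to right. For $i=1,\dots,n$ (learning $\sigma_i$ only at step $i$): (1) if $\sigma_i=+1$: (a) if some bench has an unassigned leftmost seat, assign Diner $i$ there in the lowest-numbered such bench; (b) else if a primed bench exists, assign Diner $i$ to the lowest-numbered primed bench (centre seat, or leftmost unassigned remainder seat); (c) else assign Diner $i$ to the rightmost seat of the lowest-numbered bench possible. (2) if $\sigma_i=-1$: symmetric, with (a) using unassigned rightmost seats and (c) assigning to the leftmost seat of the lowest-numbered bench possible. $\beta_C(\sigma)$ denotes the resulting bench seating arrangement (seats rotated so Diner 1 is in Seat 1). A bench is balanced if its two earliest-numbered diners have opposite preferences; $b(\beta_C(\sigma))$ is the number of balanced benches among $B_1,\dots,B_q$. -}

module Defs where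

open import Data.Bool using (Bool; true; false; not; _∧_; if_then_else_)
open import Data.Nat using (ℕ; zero; suc; _+_; _*_; _∸_; _≤_; _≡ᵇ_; _≤ᵇ_; _<ᵇ_; _⊓_; _⊔_; ⌊_/2⌋; _/_)
open import Data.Integer as ℤ using (ℤ; +_; ∣_∣)
open import Data.List using (List; []; _∷_; map; foldr; take; applyUpTo; upTo; allFin; findᵇ; length)
open import Data.Bool.ListAction using (any)
open import Data.Vec using (Vec; toList)
import Data.Vec as Vec
open import Data.Maybe using (Maybe; just; nothing; is-just)
open import Data.Fin using (Fin; toℕ)
open import Data.Fin.Permutation using (Permutation′; _⟨$⟩ʳ_; _⟨$⟩ˡ_)
open import Data.Product using (Σ; _×_; _,_)
open import Relation.Binary.PropositionalEquality using (_≡_)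

-- Preferences.  Diners, seats and napkins are indexed from 0 (Diner j
-- of the paper is index j-1, etc.).

data Sign : Set where
  plus minus : Sign      -- plus = +1 (prefers right), minus = -1 (prefers left)

val : Sign → ℤ
val plus  = + 1
val minus = ℤ.- (+ 1)

flipS : Sign → Sign
flipS plus  = minus
flipS minus = plus

negσ : ∀ {n} → Vec Sign n → Vec Sign n
negσ = Vec.map flipS

sumS : List Sign → ℤ
sumS = foldr (λ s acc → val s ℤ.+ acc) (+ 0)

driftℤ : List Sign → ℤ
driftℤ xs = foldr ℤ._⊔_ (+ 0) (applyUpTo (λ i → sumS (take (suc i) xs)) (length xs))

-- it is ≥ 0, so we take it as a natural number
drift : ∀ {n} → Vec Sign n → ℕ
drift σ = ∣ driftℤ (toList σ) ∣

-- The napkin process for a seating order.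
-- A seating order is a permutation w of the seats/diners (w ⟨$⟩ʳ i = j :
-- Diner j sits in Seat i) with w_1 = 1 (index 0 ↦ index 0).

IsSeatingOrder : ∀ {n} → Permutation′ n → Set
IsSeatingOrder {n} w = ∀ (i : Fin n) → toℕ i ≡ 0 → toℕ (w ⟨$⟩ʳ i) ≡ 0

-- napkin N_s lies between seats s and s+1 (mod n);
-- seat s has left napkin N_{s-1} and right napkin N_s
leftNapkin : ℕ → ℕ → ℕ
leftNapkin n s = if s ≡ᵇ 0 then n ∸ 1 else s ∸ 1

rightNapkin : ℕ → ℕ → ℕ
rightNapkin n s = s

prefNapkin : ℕ → Sign → ℕ → ℕ
prefNapkin n plus  s = rightNapkin n s
prefNapkin n minus s = leftNapkin n s

otherNapkin : ℕ → Sign → ℕ → ℕ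
otherNapkin n plus  s = leftNapkin n s
otherNapkin n minus s = rightNapkin n s

claimed : List ℕ → ℕ → Bool
claimed C k = any (k ≡ᵇ_) C

-- diners arrive in the order 1,…,n; the list C holds the claimed napkins;
-- the result is the number of napkinless diners
napkinRun : ∀ {n} → Permutation′ n → Vec Sign n → List (Fin n) → List ℕ → ℕ
napkinRun w σ [] C = 0
napkinRun {n} w σ (j ∷ js) C =
  let s = toℕ (w ⟨$⟩ˡ j)
      p = prefNapkin n (Vec.lookup σ j) s
      o = otherNapkin n (Vec.lookup σ j) s
  in if not (claimed C p) then napkinRun w σ js (p ∷ C)
     else if not (claimed C o) then napkinRun w σ js (o ∷ C)
     else suc (napkinRun w σ js C)

ν : ∀ {n} → Permutation′ n → Vec Sign n → ℕ
ν {n} w σ = napkinRun w σ (allFin n) []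

IsνMax : ∀ {n} → Vec Sign n → ℕ → Set
IsνMax {n} σ k =
  Σ (Permutation′ n) (λ w → IsSeatingOrder w × ν w σ ≡ k)
  × (∀ (w : Permutation′ n) → IsSeatingOrder w → ν w σ ≤ k)

-- An arrangement maps a seat index (0-based) to the diner
-- (0-based) assigned there, if any.  Bench B_{j+1} consists of the seats
-- 3j (leftmost), 3j+1 (centre), 3j+2 (rightmost), for j < q = ⌊n/3⌋;
-- seats 3q,…,n-1 are remainder seats.

Arrangement : Set
Arrangement = ℕ → Maybe ℕ

assigned : Arrangement → ℕ → Bool
assigned A k = is-just (A k)

primed : Arrangement → ℕ → Bool
primed A j = assigned A (3 * j) ∧ assigned A (3 * j + 2) ∧ not (assigned A (3 * j + 1))

benches : ℕ → List ℕ
benches n = upTo (n / 3)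

remainderSeats : ℕ → List ℕ
remainderSeats n = map (λ r → 3 * (n / 3) + r) (upTo (n ∸ 3 * (n / 3)))

primedSeat : ℕ → Arrangement → Maybe ℕ
primedSeat n A with findᵇ (primed A) (benches n)
... | just j  = just (3 * j + 1)
... | nothing = findᵇ (λ r → not (assigned A r)) (remainderSeats n)

chooseSeat : ℕ → Arrangement → Sign → Maybe ℕ
chooseSeat n A plus with findᵇ (λ j → not (assigned A (3 * j))) (benches n)
... | just j  = just (3 * j)                                   -- (a)
... | nothing with primedSeat n A
...   | just s  = just s                                       -- (b)
...   | nothing with findᵇ (λ j → not (assigned A (3 * j + 2))) (benches n)
...     | just j  = just (3 * j + 2)                           -- (c)
...     | nothing = nothing
chooseSeat n A minus with findᵇ (λ j → not (assigned A (3 * j + 2))) (benches n)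
... | just j  = just (3 * j + 2)                               -- (a)
... | nothing with primedSeat n A
...   | just s  = just s                                       -- (b)
...   | nothing with findᵇ (λ j → not (assigned A (3 * j))) (benches n)
...     | just j  = just (3 * j)                               -- (c)
...     | nothing = nothing

assign : Arrangement → Maybe ℕ → ℕ → Arrangement
assign A nothing  i = A
assign A (just s) i = λ k → if k ≡ᵇ s then just i else A k

runC : ℕ → ℕ → List Sign → Arrangement → Arrangement
runC n i []       A = A
runC n i (s ∷ ss) A = runC n (suc i) ss (assign A (chooseSeat n A s) i)

-- the bench seating arrangement β_C(σ) produced by Algorithm C
-- (in the algorithm's own seat labelling; the rotation making Diner 1
-- sit in Seat 1 does not change which diners share a bench)
βC : ∀ {n} → Vec Sign n → Arrangement
βC {n} σ = runC n 0 (toList σ) (λ _ → nothing)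

signOf : ∀ {n} → Vec Sign n → ℕ → Sign
signOf σ d = go (toList σ) d
  where
  go : List Sign → ℕ → Sign
  go []       _       = plus
  go (s ∷ ss) zero    = s
  go (s ∷ ss) (suc d) = go ss d

differ : Sign → Sign → Bool
differ plus  minus = true
differ minus plus  = true
differ _     _     = false

twoEarliest : ℕ → ℕ → ℕ → ℕ × ℕ
twoEarliest a b c =
  if (b ≤ᵇ a) ∧ (c ≤ᵇ a) then (b , c)
  else if (c ≤ᵇ b) then (a , c)
  else (a , b)

balancedᵇ : ∀ {n} → Vec Sign n → Arrangement → ℕ → Bool
balancedᵇ σ A j with A (3 * j) | A (3 * j + 1) | A (3 * j + 2)
... | just a | just b | just c with twoEarliest a b c
...   | (x , y) = differ (signOf σ x) (signOf σ y)
balancedᵇ σ A j | _ | _ | _ = false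

count : (ℕ → Bool) → List ℕ → ℕ
count p []       = 0
count p (x ∷ xs) = if p x then suc (count p xs) else count p xs

b : ∀ {n} → Vec Sign n → Arrangement → ℕ
b {n} σ A = count (balancedᵇ σ A) (benches n)

-- In any seating order both neighbours of a napkinless diner took the napkins next to
-- it; charging the diner to them gives 3ν ≤ n.  Passing charges along maximal runs of diners who took
-- the napkin on the same side shows that a prefix of σ with p plus and m minus diners satisfies
-- p + 2ν ≤ n + m (and symmetrically), so 2ν ≤ n − h.  Algorithm C fills leftmost seats with plus diners and rightmost seats with minus
-- diners for as long as it can, and a centre only after both ends of its bench.  Along the run, all
-- benches with both ends filled have ends of opposite preference, except for at most as many as
-- there are diners displaced to the wrong end by rule (c), and each displaced diner is paid for by
-- the drift of a prefix; so b(β_C) ≥ min(q, ⌊(n − h)/2⌋).  Seating the diners as β_C does (rotated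
-- so that Diner 1 sits in Seat 1), the centre of a balanced bench arrives after a left neighbour
-- preferring right and a right neighbour preferring left, so it is napkinless and ν_max ≥ b(β_C).
module Submission where

module Booleans where

  open import Data.Bool using (Bool; true; false; T)
  open import Data.Unit using (tt)
  open import Data.Nat
  open import Data.Nat.Properties
  open import Data.Empty using (⊥-elim)
  open import Relation.Nullary using (yes; no)
  open import Relation.Binary.PropositionalEquality

  T→≡ : ∀ {b} → T b → b ≡ true
  T→≡ {true} _ = refl

  ≡→T : ∀ {b} → b ≡ true → T b
  ≡→T refl = tt

  ≡ᵇ-true : ∀ {a b} → (a ≡ᵇ b) ≡ true → a ≡ b
  ≡ᵇ-true {a} {b} e = ≡ᵇ⇒≡ a b (≡→T e)

  ≡ᵇ-false : ∀ {a b} → (a ≡ᵇ b) ≡ false → a ≢ b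
  ≡ᵇ-false {a} {b} e a≡b with trans (sym e) (T→≡ (≡⇒≡ᵇ a b a≡b))
  ... | ()

  ≡ᵇ-refl : ∀ a → (a ≡ᵇ a) ≡ true
  ≡ᵇ-refl a = T→≡ (≡⇒≡ᵇ a a refl)

  ≢→≡ᵇ : ∀ {a b} → a ≢ b → (a ≡ᵇ b) ≡ false
  ≢→≡ᵇ {a} {b} ne with a ≡ᵇ b in e
  ... | true = ⊥-elim (ne (≡ᵇ-true e))
  ... | false = refl

  <ᵇ-true : ∀ {a b} → (a <ᵇ b) ≡ true → a < b
  <ᵇ-true {a} {b} e = <ᵇ⇒< a b (≡→T e)

  <→<ᵇ : ∀ {a b} → a < b → (a <ᵇ b) ≡ true
  <→<ᵇ {a} {b} lt = T→≡ (<⇒<ᵇ lt)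

  <ᵇ-false : ∀ {a b} → (a <ᵇ b) ≡ false → b ≤ a
  <ᵇ-false {a} {b} e with a <? b
  ... | yes lt with () ← trans (sym e) (<→<ᵇ lt)
  ... | no nlt = ≮⇒≥ nlt

  ≤→<ᵇ : ∀ {a b} → b ≤ a → (a <ᵇ b) ≡ false
  ≤→<ᵇ {a} {b} le with a <ᵇ b in e
  ... | true = ⊥-elim (<⇒≱ (<ᵇ-true e) le)
  ... | false = refl

  <ᵇ-suc : ∀ j x → j ≢ x → (j <ᵇ suc x) ≡ (j <ᵇ x)
  <ᵇ-suc j x ne with j <ᵇ x in e1 | j <ᵇ suc x in e2
  ... | true | true = refl
  ... | false | false = refl
  ... | true | false = ⊥-elim (<-asym (<ᵇ-true e1) (<-≤-trans (n<1+n x) (<ᵇ-false e2)))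
  ... | false | true = ⊥-elim (ne (≤-antisym (≤-pred (<ᵇ-true e2)) (<ᵇ-false e1)))

  ≤→≤ᵇ : ∀ {u v} → u ≤ v → (u ≤ᵇ v) ≡ true
  ≤→≤ᵇ le = T→≡ (≤⇒≤ᵇ le)

  <ᵇ-downward : ∀ {a b} k → a < b → (b <ᵇ k) ≡ true → (a <ᵇ k) ≡ true
  <ᵇ-downward {a} {b} k a<b e = <→<ᵇ {a} {k} (<-trans a<b (<ᵇ-true {b} {k} e))

  <→≤ᵇ : ∀ {u v} → u < v → (v ≤ᵇ u) ≡ false
  <→≤ᵇ {u} {v} lt with v ≤ᵇ u in e
  ... | true = ⊥-elim (<⇒≱ lt (≤ᵇ⇒≤ v u (≡→T e)))
  ... | false = refl


module Sums where

  open import Data.Bool using (Bool; true; false; if_then_else_; _∧_)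
  open import Data.Nat
  open import Data.Nat.Properties
  open import Data.Fin using (Fin; zero; suc; toℕ)
  open import Data.Fin.Properties using (toℕ-injective; toℕ<n)
  open import Data.Fin.Permutation using (Permutation′; permutation; _⟨$⟩ʳ_)
  open import Data.List using (applyUpTo)
  open import Data.Sum using (inj₁; inj₂)
  open import Relation.Nullary using (yes; no)
  open import Relation.Binary.PropositionalEquality
  open import Algebra.Properties.CommutativeMonoid.Sum +-0-commutativeMonoid using (sum; sum-permute; sum-cong-≗)
  open import Algebra.Properties.CommutativeSemigroup +-commutativeSemigroup using (interchange)
  open import Data.Vec.Functional using (rearrange)
  open import Defs using (count)
  open Booleans

  ι : Bool → ℕ
  ι true = 1
  ι false = 0

  ι≤1 : ∀ b → ι b ≤ 1
  ι≤1 true = s≤s z≤n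
  ι≤1 false = z≤n

  ΣN : ℕ → (ℕ → ℕ) → ℕ
  ΣN zero g = 0
  ΣN (suc n) g = ΣN n g + g n

  ΣN-front : ∀ n g → ΣN (suc n) g ≡ g 0 + ΣN n (λ i → g (suc i))
  ΣN-front zero g = +-comm 0 (g 0)
  ΣN-front (suc n) g = begin
      ΣN (suc n) g + g (suc n)                   ≡⟨ cong (_+ g (suc n)) (ΣN-front n g) ⟩
      g 0 + ΣN n (λ i → g (suc i)) + g (suc n)   ≡⟨ +-assoc (g 0) _ _ ⟩
      g 0 + (ΣN n (λ i → g (suc i)) + g (suc n)) ∎
    where open ≡-Reasoning

  ΣN-cong : ∀ n {f g} → (∀ i → i < n → f i ≡ g i) → ΣN n f ≡ ΣN n g
  ΣN-cong zero h = refl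
  ΣN-cong (suc n) h = cong₂ _+_ (ΣN-cong n (λ i i<n → h i (m<n⇒m<1+n i<n))) (h n ≤-refl)

  ΣN-mono : ∀ n {f g} → (∀ i → i < n → f i ≤ g i) → ΣN n f ≤ ΣN n g
  ΣN-mono zero h = z≤n
  ΣN-mono (suc n) h = +-mono-≤ (ΣN-mono n (λ i i<n → h i (m<n⇒m<1+n i<n))) (h n ≤-refl)

  ΣN-monoˡ : ∀ {m n} f → m ≤ n → ΣN m f ≤ ΣN n f
  ΣN-monoˡ f m≤n with m≤n⇒m<n∨m≡n m≤n
  ... | inj₂ refl = ≤-refl
  ΣN-monoˡ {n = suc n} f _ | inj₁ m<1+n = ≤-trans (ΣN-monoˡ f (≤-pred m<1+n)) (m≤m+n _ _)

  ΣN-+ : ∀ n f g → ΣN n (λ i → f i + g i) ≡ ΣN n f + ΣN n g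
  ΣN-+ zero f g = refl
  ΣN-+ (suc n) f g = trans (cong (_+ (f n + g n)) (ΣN-+ n f g)) (interchange (ΣN n f) (ΣN n g) (f n) (g n))

  ΣN-*ˡ : ∀ k n f → ΣN n (λ i → k * f i) ≡ k * ΣN n f
  ΣN-*ˡ k zero f = sym (*-zeroʳ k)
  ΣN-*ˡ k (suc n) f = trans (cong (_+ k * f n) (ΣN-*ˡ k n f)) (sym (*-distribˡ-+ k (ΣN n f) (f n)))

  ΣN-1 : ∀ n → ΣN n (λ _ → 1) ≡ n
  ΣN-1 zero = refl
  ΣN-1 (suc n) = trans (cong (_+ 1) (ΣN-1 n)) (+-comm n 1)

  ΣN-truncate : ∀ n k f → k ≤ n → (∀ i → k ≤ i → f i ≡ 0) → ΣN n f ≡ ΣN k f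
  ΣN-truncate n k f k≤n h with m≤n⇒m<n∨m≡n k≤n
  ... | inj₂ refl = refl
  ΣN-truncate (suc n) k f k≤n h | inj₁ k<sn rewrite h n (≤-pred k<sn) | +-identityʳ (ΣN n f) = ΣN-truncate n k f (≤-pred k<sn) h

  ΣN-prefix : ∀ n k (p : ℕ → Bool) → k ≤ n → ΣN n (λ t → ι ((t <ᵇ k) ∧ p t)) ≡ ΣN k (λ t → ι (p t))
  ΣN-prefix n k p k≤n = trans (ΣN-truncate n k _ k≤n (λ i k≤i → cong (λ b → ι (b ∧ p i)) (≤→<ᵇ k≤i)))
                            (ΣN-cong k (λ i i<k → cong (λ b → ι (b ∧ p i)) (<→<ᵇ i<k)))

  ΣN-update : ∀ m (f g : ℕ → ℕ) j₀ → j₀ < m → f j₀ ≡ 0 → (∀ j → j < m → j ≢ j₀ → f j ≡ g j) → ΣN m f + g j₀ ≡ ΣN m g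
  ΣN-update (suc m) f g j₀ lt f0 h with j₀ ≟ m
  ... | yes refl rewrite f0 | +-identityʳ (ΣN j₀ f) =
        cong (_+ g j₀) (ΣN-cong j₀ (λ j j<m → h j (m<n⇒m<1+n j<m) (λ e → <-irrefl e j<m)))
  ... | no ne rewrite h m ≤-refl (λ e → ne (sym e)) = begin
        ΣN m f + g m + g j₀   ≡⟨ +-assoc (ΣN m f) _ _ ⟩
        ΣN m f + (g m + g j₀) ≡⟨ cong (ΣN m f +_) (+-comm (g m) (g j₀)) ⟩
        ΣN m f + (g j₀ + g m) ≡⟨ sym (+-assoc (ΣN m f) _ _) ⟩
        ΣN m f + g j₀ + g m   ≡⟨ cong (_+ g m) (ΣN-update m f g j₀ (≤∧≢⇒< (≤-pred lt) ne) f0 (λ j j<m → h j (m<n⇒m<1+n j<m))) ⟩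
        ΣN m g + g m ∎
    where open ≡-Reasoning

  ΣN-triples : ∀ q g → ΣN (3 * q) g ≡ ΣN q (λ j → g (3 * j) + g (3 * j + 1) + g (3 * j + 2))
  ΣN-triples zero g = refl
  ΣN-triples (suc q) g = begin
      ΣN (3 * suc q) g ≡⟨ cong (λ z → ΣN z g) (*-suc 3 q) ⟩
      ΣN (3 * q) g + g (3 * q) + g (suc (3 * q)) + g (suc (suc (3 * q)))
        ≡⟨ cong₂ (λ a b → ΣN (3 * q) g + g (3 * q) + g a + g b) (+-comm 1 (3 * q)) (+-comm 2 (3 * q)) ⟩
      ΣN (3 * q) g + g (3 * q) + g (3 * q + 1) + g (3 * q + 2)
        ≡⟨ trans (+-assoc (ΣN (3 * q) g + g (3 * q)) _ _) (+-assoc (ΣN (3 * q) g) _ _) ⟩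
      ΣN (3 * q) g + (g (3 * q) + (g (3 * q + 1) + g (3 * q + 2)))
        ≡⟨ cong₂ _+_ (ΣN-triples q g) (sym (+-assoc (g (3 * q)) _ _)) ⟩
      ΣN q (λ j → g (3 * j) + g (3 * j + 1) + g (3 * j + 2)) + (g (3 * q) + g (3 * q + 1) + g (3 * q + 2)) ∎
    where open ≡-Reasoning

  count-applyUpTo : ∀ (p : ℕ → Bool) (f : ℕ → ℕ) m → count p (applyUpTo f m) ≡ ΣN m (λ i → ι (p (f i)))
  count-applyUpTo p f zero = refl
  count-applyUpTo p f (suc m) = trans (head (p (f 0))) (sym (ΣN-front m (λ i → ι (p (f i)))))
    where
    rest = count p (applyUpTo (λ i → f (suc i)) m)
    head : ∀ b → (if b then suc rest else rest) ≡ ι b + ΣN m (λ i → ι (p (f (suc i))))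
    head true = cong suc (count-applyUpTo p (λ i → f (suc i)) m)
    head false = count-applyUpTo p (λ i → f (suc i)) m

  ΣN-≤-transfer : ∀ n (a b F G : ℕ → ℕ) →
    ΣN n G ≡ ΣN n F →
    (∀ s → s < n → a s + F s ≤ b s + G s) → ΣN n a ≤ ΣN n b
  ΣN-≤-transfer n a b F G rot h = +-cancelʳ-≤ (ΣN n F) _ _ (begin
      ΣN n a + ΣN n F        ≡⟨ sym (ΣN-+ n a F) ⟩
      ΣN n (λ s → a s + F s) ≤⟨ ΣN-mono n h ⟩
      ΣN n (λ s → b s + G s) ≡⟨ ΣN-+ n b G ⟩
      ΣN n b + ΣN n G        ≡⟨ cong (ΣN n b +_) rot ⟩
      ΣN n b + ΣN n F        ∎)
    where open ≤-Reasoning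

  clamp : ∀ n → ℕ → Fin (suc n)
  clamp zero t = zero
  clamp (suc n) zero = zero
  clamp (suc n) (suc t) = suc (clamp n t)

  toℕ-clamp : ∀ n t → t ≤ n → toℕ (clamp n t) ≡ t
  toℕ-clamp zero zero _ = refl
  toℕ-clamp (suc n) zero _ = refl
  toℕ-clamp (suc n) (suc t) (s≤s le) = cong suc (toℕ-clamp n t le)

  clamp-toℕ : ∀ n (i : Fin (suc n)) → clamp n (toℕ i) ≡ i
  clamp-toℕ zero zero = refl
  clamp-toℕ (suc n) zero = refl
  clamp-toℕ (suc n) (suc i) = cong suc (clamp-toℕ n i)

  ΣN≡sum : ∀ n (g : ℕ → ℕ) → ΣN n g ≡ sum (λ (i : Fin n) → g (toℕ i))
  ΣN≡sum zero g = refl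
  ΣN≡sum (suc n) g = trans (ΣN-front n g) (cong (g 0 +_) (ΣN≡sum n (λ i → g (suc i))))

  module PermutationFrom (n₁ : ℕ) (f g : ℕ → ℕ)
    (f< : ∀ s → s < suc n₁ → f s < suc n₁) (g< : ∀ s → s < suc n₁ → g s < suc n₁)
    (gf : ∀ s → s < suc n₁ → g (f s) ≡ s) (fg : ∀ s → s < suc n₁ → f (g s) ≡ s) where

    toF : Fin (suc n₁) → Fin (suc n₁)
    toF i = clamp n₁ (g (toℕ i))

    fromF : Fin (suc n₁) → Fin (suc n₁)
    fromF i = clamp n₁ (f (toℕ i))

    toℕ-toF : ∀ i → toℕ (toF i) ≡ g (toℕ i)
    toℕ-toF i = toℕ-clamp n₁ _ (≤-pred (g< _ (toℕ<n i)))

    toℕ-fromF : ∀ i → toℕ (fromF i) ≡ f (toℕ i)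
    toℕ-fromF i = toℕ-clamp n₁ _ (≤-pred (f< _ (toℕ<n i)))

    perm : Permutation′ (suc n₁)
    perm = permutation toF fromF
      (λ y → toℕ-injective (trans (toℕ-toF (fromF y)) (trans (cong g (toℕ-fromF y)) (gf _ (toℕ<n y)))))
      (λ y → toℕ-injective (trans (toℕ-fromF (toF y)) (trans (cong f (toℕ-toF y)) (fg _ (toℕ<n y)))))

    ΣN-reindex : ∀ (h : ℕ → ℕ) → ΣN (suc n₁) (λ s → h (g s)) ≡ ΣN (suc n₁) h
    ΣN-reindex h = begin
        ΣN (suc n₁) (λ s → h (g s))                              ≡⟨ ΣN≡sum (suc n₁) _ ⟩
        sum {suc n₁} (λ i → h (g (toℕ i)))                       ≡⟨ sum-cong-≗ (λ i → cong h (sym (toℕ-toF i))) ⟩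
        sum {suc n₁} (rearrange (perm ⟨$⟩ʳ_) (λ i → h (toℕ i)))  ≡⟨ sym (sum-permute (λ i → h (toℕ i)) perm) ⟩
        sum {suc n₁} (λ i → h (toℕ i))                           ≡⟨ sym (ΣN≡sum (suc n₁) h) ⟩
        ΣN (suc n₁) h                                            ∎
      where open ≡-Reasoning


module Charging where

  open import Data.Bool using (Bool; true; false; not; _∧_; if_then_else_)
  open import Data.Nat
  open import Data.Nat.Properties
  open import Data.Product using (_×_; _,_; proj₁; proj₂)
  open import Relation.Binary.PropositionalEquality
  open Sums

  -- Used with next = successor seat, A = took the left napkin, S = among the first k diners and
  -- P = prefers the right napkin; the charge F s = [A s] (1 + [S s]) is passed on from s to next s.
  module PrefixCharging (n : ℕ) (next : ℕ → ℕ) (next-perm : ∀ h → ΣN n (λ s → h (next s)) ≡ ΣN n h)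
    (X A S P : ℕ → Bool)
    (X⇒A-next : ∀ s → s < n → X s ≡ true → A (next s) ≡ true × (S s ≡ true → S (next s) ≡ true))
    (AP⇒A-next : ∀ s → s < n → A s ≡ true → P s ≡ true → A (next s) ≡ true × (S s ≡ true → S (next s) ≡ true))
    (X⇒¬A : ∀ s → s < n → X s ≡ true → A s ≡ false) where

    F : ℕ → ℕ
    F s = if A s then (if S s then 2 else 1) else 0

    a b : ℕ → ℕ
    a s = ι (S s ∧ P s) + 2 * ι (X s)
    b s = 1 + ι (S s ∧ not (P s))

    local : ∀ s → s < n → a s + F s ≤ b s + F (next s)
    local s s<n with X s in eX | A s in eA | S s in eS | P s in eP | A (next s) in eNA | S (next s) in eNS
    ... | true | true | _ | _ | _ | _ with () ← trans (sym (X⇒¬A s s<n eX)) eA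
    ... | true | false | _ | _ | false | _ with () ← trans (sym eNA) (proj₁ (X⇒A-next s s<n eX))
    ... | true | false | true | _ | true | false with () ← trans (sym eNS) (proj₂ (X⇒A-next s s<n eX) eS)
    ... | true | false | true | true | true | true = ≤ᵇ⇒≤ _ _ _
    ... | true | false | true | false | true | true = ≤ᵇ⇒≤ _ _ _
    ... | true | false | false | _ | true | true = ≤ᵇ⇒≤ _ _ _
    ... | true | false | false | _ | true | false = ≤ᵇ⇒≤ _ _ _
    ... | false | false | true | true | _ | _ = ≤ᵇ⇒≤ _ _ _
    ... | false | false | true | false | _ | _ = ≤ᵇ⇒≤ _ _ _
    ... | false | false | false | _ | _ | _ = ≤ᵇ⇒≤ _ _ _
    ... | false | true | true | true | false | _ with () ← trans (sym eNA) (proj₁ (AP⇒A-next s s<n eA eP))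
    ... | false | true | true | true | true | false with () ← trans (sym eNS) (proj₂ (AP⇒A-next s s<n eA eP) eS)
    ... | false | true | true | true | true | true = ≤ᵇ⇒≤ _ _ _
    ... | false | true | true | false | false | _ = ≤ᵇ⇒≤ _ _ _
    ... | false | true | true | false | true | true = ≤ᵇ⇒≤ _ _ _
    ... | false | true | true | false | true | false = ≤ᵇ⇒≤ _ _ _
    ... | false | true | false | _ | false | _ = ≤ᵇ⇒≤ _ _ _
    ... | false | true | false | _ | true | true = ≤ᵇ⇒≤ _ _ _
    ... | false | true | false | _ | true | false = ≤ᵇ⇒≤ _ _ _

    prefix-charging : ΣN n (λ s → ι (S s ∧ P s)) + 2 * ΣN n (λ s → ι (X s)) ≤ n + ΣN n (λ s → ι (S s ∧ not (P s)))
    prefix-charging = begin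
        ΣN n (λ s → ι (S s ∧ P s)) + 2 * ΣN n (λ s → ι (X s))
          ≡⟨ cong (ΣN n (λ s → ι (S s ∧ P s)) +_) (sym (ΣN-*ˡ 2 n (λ s → ι (X s)))) ⟩
        ΣN n (λ s → ι (S s ∧ P s)) + ΣN n (λ s → 2 * ι (X s))   ≡⟨ sym (ΣN-+ n _ _) ⟩
        ΣN n a                                                 ≤⟨ ΣN-≤-transfer n a b F (λ s → F (next s)) (next-perm F) local ⟩
        ΣN n b                                                 ≡⟨ ΣN-+ n (λ _ → 1) _ ⟩
        ΣN n (λ _ → 1) + ΣN n (λ s → ι (S s ∧ not (P s)))      ≡⟨ cong (_+ ΣN n (λ s → ι (S s ∧ not (P s)))) (ΣN-1 n) ⟩
        n + ΣN n (λ s → ι (S s ∧ not (P s)))                   ∎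
      where open ≤-Reasoning

  -- Each napkinless seat receives one unit from each neighbour, and an L- or R-seat gives at most one.
  module NapkinlessCharging (n : ℕ) (succ pred : ℕ → ℕ)
    (succ-perm : ∀ h → ΣN n (λ s → h (succ s)) ≡ ΣN n h)
    (pred-perm : ∀ h → ΣN n (λ s → h (pred s)) ≡ ΣN n h)
    (L R X : ℕ → Bool)
    (succ-pred : ∀ s → s < n → succ (pred s) ≡ s) (pred-succ : ∀ s → s < n → pred (succ s) ≡ s)
    (X⇒neighbours : ∀ s → s < n → X s ≡ true → L (succ s) ≡ true × R (pred s) ≡ true)
    (X⇒¬L : ∀ s → s < n → X s ≡ true → L s ≡ false)
    (X⇒¬R : ∀ s → s < n → X s ≡ true → R s ≡ false)
    (L⇒¬R : ∀ s → s < n → L s ≡ true → R s ≡ false) where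

    toSucc toPred : ℕ → ℕ
    toSucc s = ι (R s ∧ X (succ s))
    toPred s = ι (L s ∧ X (pred s))

    local : ∀ s → s < n → 3 * ι (X s) + (toSucc s + toPred s) ≤ 1 + (toSucc (pred s) + toPred (succ s))
    local s s<n with X s in eX
    ... | true with X⇒neighbours s s<n eX | X⇒¬L s s<n eX | X⇒¬R s s<n eX
    ...   | (l , r) | xl | xr rewrite xl | xr | r | l | succ-pred s s<n | pred-succ s s<n | eX = ≤-refl
    local s s<n | false with L s in eL | R s in eR
    ... | true | true with () ← trans (sym eR) (L⇒¬R s s<n eL)
    local s s<n | false | true | false = ≤-trans (ι≤1 _) (s≤s z≤n)
    local s s<n | false | false | true rewrite +-identityʳ (ι (X (succ s))) = ≤-trans (ι≤1 _) (s≤s z≤n)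
    local s s<n | false | false | false = z≤n

    3*ΣX≤n : 3 * ΣN n (λ s → ι (X s)) ≤ n
    3*ΣX≤n = begin
        3 * ΣN n (λ s → ι (X s)) ≡⟨ sym (ΣN-*ˡ 3 n _) ⟩
        ΣN n (λ s → 3 * ι (X s)) ≤⟨ ΣN-≤-transfer n (λ s → 3 * ι (X s)) (λ _ → 1) (λ s → toSucc s + toPred s)
                                      (λ s → toSucc (pred s) + toPred (succ s)) rearranged local ⟩
        ΣN n (λ _ → 1)           ≡⟨ ΣN-1 n ⟩
        n                        ∎
      where
      open ≤-Reasoning
      rearranged : ΣN n (λ s → toSucc (pred s) + toPred (succ s)) ≡ ΣN n (λ s → toSucc s + toPred s)
      rearranged = trans (ΣN-+ n _ _) (trans (cong₂ _+_ (pred-perm toSucc) (succ-perm toPred)) (sym (ΣN-+ n toSucc toPred)))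


module Cyclic where

  open import Data.Bool using (true; false; if_then_else_)
  open import Data.Nat
  open import Data.Nat.Properties
  open import Data.Nat.GeneralisedArithmetic using (iterate)
  open import Data.Empty using (⊥-elim)
  open import Relation.Binary.PropositionalEquality
  open import Defs using (leftNapkin)
  open Booleans

  module CyclicOrder (m : ℕ) where
    N : ℕ
    N = suc m

    predN : ℕ → ℕ
    predN = leftNapkin N

    succN : ℕ → ℕ
    succN s = if suc s ≡ᵇ N then 0 else suc s

    predN-< : ∀ s → s < N → predN s < N
    predN-< zero _ = ≤-refl
    predN-< (suc s) lt = m<n⇒m<1+n (≤-pred lt)

    succN-< : ∀ s → s < N → succN s < N
    succN-< s lt with suc s ≡ᵇ N in e
    ... | true = s≤s z≤n
    ... | false = ≤∧≢⇒< lt (≡ᵇ-false e)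

    predN-succN : ∀ s → s < N → predN (succN s) ≡ s
    predN-succN s lt with suc s ≡ᵇ N in e
    ... | true = suc-injective (sym (≡ᵇ-true e))
    ... | false = refl

    succN-predN : ∀ s → s < N → succN (predN s) ≡ s
    succN-predN zero lt rewrite ≡ᵇ-refl m = refl
    succN-predN (suc s) lt with suc s ≡ᵇ N in e
    ... | true = ⊥-elim (<-irrefl (≡ᵇ-true e) lt)
    ... | false = refl

    succN-suc : ∀ s → suc s < N → succN s ≡ suc s
    succN-suc s lt with suc s ≡ᵇ N in e
    ... | true = ⊥-elim (<-irrefl (≡ᵇ-true e) lt)
    ... | false = refl

    predN-injective : ∀ s t → s < N → t < N → predN s ≡ predN t → s ≡ t
    predN-injective s t ls lt e = trans (sym (succN-predN s ls)) (trans (cong succN e) (succN-predN t lt))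

  module CyclicOrder₂ (m₁ : ℕ) where
    open CyclicOrder (suc m₁) public

    predN-≢ : ∀ s → predN s ≢ s
    predN-≢ zero ()
    predN-≢ (suc s) e = <-irrefl e (n<1+n s)

  iterate-comm : ∀ (f : ℕ → ℕ) s d → iterate f (f s) d ≡ f (iterate f s d)
  iterate-comm f s zero = refl
  iterate-comm f s (suc d) = iterate-comm f (f s) d

  module Rotation (m : ℕ) where
    open CyclicOrder m

    iterate-< : ∀ f → (∀ s → s < N → f s < N) → ∀ d s → s < N → iterate f s d < N
    iterate-< f f< zero s lt = lt
    iterate-< f f< (suc d) s lt = iterate-< f f< d (f s) (f< s lt)

    iterate-inverse : ∀ f g → (∀ s → s < N → f s < N) → (∀ s → s < N → g (f s) ≡ s) →
                      ∀ d s → s < N → iterate g (iterate f s d) d ≡ s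
    iterate-inverse f g f< gf zero s lt = refl
    iterate-inverse f g f< gf (suc d) s lt =
      trans (cong (λ x → iterate g x d) (trans (cong g (iterate-comm f s d)) (gf _ (iterate-< f f< d s lt))))
            (iterate-inverse f g f< gf d s lt)

    iterate-predN-succN : ∀ d s → s < N → iterate predN (succN s) d ≡ succN (iterate predN s d)
    iterate-predN-succN zero s lt = refl
    iterate-predN-succN (suc d) s lt = trans (cong (λ x → iterate predN x d) (predN-succN s lt))
       (sym (trans (cong succN (iterate-comm predN s d)) (succN-predN _ (iterate-< predN predN-< d s lt))))

    iterate-succN-0 : ∀ d → d < N → iterate succN 0 d ≡ d
    iterate-succN-0 zero _ = refl
    iterate-succN-0 (suc d) lt =
      trans (iterate-comm succN 0 d) (trans (cong succN (iterate-succN-0 d (<-trans (n<1+n d) lt))) (succN-suc d lt))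


module Signs where

  open import Data.Bool using (Bool; true; false; not)
  open import Data.Nat using (ℕ)
  open import Data.Vec using (Vec)
  open import Relation.Binary.PropositionalEquality
  open import Defs
  open Sums

  isPlus : Sign → Bool
  isPlus plus = true
  isPlus minus = false

  isPlus-true : ∀ {s} → isPlus s ≡ true → s ≡ plus
  isPlus-true {plus} _ = refl

  not-isPlus-true : ∀ {s} → not (isPlus s) ≡ true → s ≡ minus
  not-isPlus-true {minus} _ = refl

  isPlus-flipS : ∀ s → isPlus (flipS s) ≡ not (isPlus s)
  isPlus-flipS plus = refl
  isPlus-flipS minus = refl

  plusCount minusCount : ∀ {n} → Vec Sign n → ℕ → ℕ
  plusCount σ k = ΣN k (λ t → ι (isPlus (signOf σ t)))
  minusCount σ k = ΣN k (λ t → ι (not (isPlus (signOf σ t))))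


module Napkins where

  open import Data.Bool using (Bool; true; false; not; _∧_; if_then_else_)
  open import Data.Bool.Properties using (∨-zeroʳ; not-involutive)
  open import Data.Nat
  open import Data.Nat.Properties
  open import Data.Fin using (Fin; toℕ)
  open import Data.Fin.Properties using (toℕ<n)
  open import Data.Fin.Permutation using (Permutation′; _⟨$⟩ʳ_; _⟨$⟩ˡ_; inverseˡ; inverseʳ)
  open import Data.Product using (Σ; _×_; _,_; proj₁; proj₂)
  open import Data.Sum using (_⊎_; inj₁; inj₂)
  open import Data.Empty using (⊥-elim)
  open import Data.List using (List; []; _∷_; tabulate)
  open import Data.List.Properties using (tabulate-cong)
  open import Data.Vec using (Vec)
  import Data.Vec as Vec
  open import Data.Maybe using (Maybe; just; nothing)
  open import Data.Maybe.Properties using (just-injective)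
  open import Function using (case_of_)
  open import Relation.Binary.PropositionalEquality
  open import Defs
  open Booleans
  open Sums
  open Cyclic
  open Charging
  open Signs

  lookup-clamp : ∀ m (σ : Vec Sign (suc m)) t → t ≤ m → Vec.lookup σ (clamp m t) ≡ signOf σ t
  lookup-clamp zero (x Vec.∷ Vec.[]) zero _ = refl
  lookup-clamp (suc m) (x Vec.∷ σ) zero _ = refl
  lookup-clamp (suc m) (x Vec.∷ σ) (suc t) (s≤s le) = lookup-clamp m σ t le

  module Run (n₁ : ℕ) (w : Permutation′ (suc (suc n₁))) (σ : Vec Sign (suc (suc n₁))) where
    open CyclicOrder₂ n₁ public

    fin : ℕ → Fin N
    fin = clamp (suc n₁)

    seat dinerAt : ℕ → ℕ
    seat t = toℕ (w ⟨$⟩ˡ fin t)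
    dinerAt s = toℕ (w ⟨$⟩ʳ fin s)

    sgn : ℕ → Sign
    sgn t = Vec.lookup σ (fin t)

    prefN otherN : ℕ → ℕ
    prefN t = prefNapkin N (sgn t) (seat t)
    otherN t = otherNapkin N (sgn t) (seat t)

    claim : ℕ → List ℕ → Maybe ℕ
    claim t C = if not (claimed C (prefN t)) then just (prefN t)
                  else if not (claimed C (otherN t)) then just (otherN t) else nothing

    addClaim : Maybe ℕ → List ℕ → List ℕ
    addClaim (just x) C = x ∷ C
    addClaim nothing C = C

    claimedBefore : ℕ → List ℕ
    claimedBefore zero = []
    claimedBefore (suc t) = addClaim (claim t (claimedBefore t)) (claimedBefore t)

    napkinOf : ℕ → Maybe ℕ
    napkinOf t = claim t (claimedBefore t)

    napkinless tookLeft tookRight : ℕ → Bool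
    napkinless t with napkinOf t
    ... | just _ = false
    ... | nothing = true
    tookLeft t with napkinOf t
    ... | just x = not (x ≡ᵇ seat t)
    ... | nothing = false
    tookRight t with napkinOf t
    ... | just x = x ≡ᵇ seat t
    ... | nothing = false

    run-count : ∀ m t → napkinRun w σ (tabulate {n = m} (λ i → fin (t + toℕ i))) (claimedBefore t) ≡ ΣN m (λ i → ι (napkinless (t + i)))
    run-count zero t = refl
    run-count (suc m) t = begin
        napkinRun w σ (fin (t + 0) ∷ tabulate {n = m} (λ i → fin (t + suc (toℕ i)))) (claimedBefore t)
          ≡⟨ cong₂ (λ a l → napkinRun w σ (fin a ∷ l) (claimedBefore t)) (+-identityʳ t) (tabulate-cong {n = m} (λ i → cong fin (+-suc t (toℕ i)))) ⟩
        napkinRun w σ (fin t ∷ tabulate {n = m} (λ i → fin (suc t + toℕ i))) (claimedBefore t) ≡⟨ step ⟩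
        ι (napkinless t) + ΣN m (λ i → ι (napkinless (suc t + i))) ≡⟨ cong₂ _+_ (cong (λ z → ι (napkinless z)) (sym (+-identityʳ t))) (ΣN-cong m (λ i _ → cong (λ z → ι (napkinless z)) (sym (+-suc t i)))) ⟩
        ι (napkinless (t + 0)) + ΣN m (λ i → ι (napkinless (t + suc i))) ≡⟨ sym (ΣN-front m (λ i → ι (napkinless (t + i)))) ⟩
        ΣN (suc m) (λ i → ι (napkinless (t + i))) ∎
      where
      open ≡-Reasoning
      step : napkinRun w σ (fin t ∷ tabulate {n = m} (λ i → fin (suc t + toℕ i))) (claimedBefore t) ≡ ι (napkinless t) + ΣN m (λ i → ι (napkinless (suc t + i)))
      step with claimed (claimedBefore t) (prefN t) | claimed (claimedBefore t) (otherN t) | run-count m (suc t)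
      ... | false | _ | rc = rc
      ... | true | false | rc = rc
      ... | true | true | rc = cong suc rc

    ν-count : ν w σ ≡ ΣN N (λ t → ι (napkinless t))
    ν-count = trans (cong (λ l → napkinRun w σ l []) (tabulate-cong (λ i → sym (clamp-toℕ (suc n₁) i)))) (run-count N 0)

    addClaim-mono : ∀ m C x → claimed C x ≡ true → claimed (addClaim m C) x ≡ true
    addClaim-mono nothing C x e = e
    addClaim-mono (just y) C x e rewrite e = ∨-zeroʳ (x ≡ᵇ y)

    claimed⇒napkinOf : ∀ t x → claimed (claimedBefore t) x ≡ true → Σ ℕ (λ u → u < t × napkinOf u ≡ just x)
    claimed⇒napkinOf zero x ()
    claimed⇒napkinOf (suc t) x e with claim t (claimedBefore t) in eg
    ... | nothing with claimed⇒napkinOf t x e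
    ...   | (u , u<t , gu) = u , m<n⇒m<1+n u<t , gu
    claimed⇒napkinOf (suc t) x e | just y with x ≡ᵇ y in exy
    ...   | true = t , ≤-refl , trans eg (cong just (sym (≡ᵇ-true exy)))
    ...   | false with claimed⇒napkinOf t x e
    ...     | (u , u<t , gu) = u , m<n⇒m<1+n u<t , gu

    napkinOf⇒claimed : ∀ t u x → u < t → napkinOf u ≡ just x → claimed (claimedBefore t) x ≡ true
    napkinOf⇒claimed (suc t) u x u<t gu with m≤n⇒m<n∨m≡n (≤-pred u<t)
    ... | inj₁ u<t' = addClaim-mono (napkinOf t) (claimedBefore t) x (napkinOf⇒claimed t u x u<t' gu)
    ... | inj₂ refl rewrite gu | ≡ᵇ-refl x = refl

    napkinOf-nothing : ∀ t → napkinOf t ≡ nothing →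
        claimed (claimedBefore t) (prefN t) ≡ true × claimed (claimedBefore t) (otherN t) ≡ true
    napkinOf-nothing t e with claimed (claimedBefore t) (prefN t) | claimed (claimedBefore t) (otherN t)
    ... | true | true = refl , refl
    ... | true | false with () ← e
    ... | false | _ with () ← e

    napkinOf-just : ∀ t x → napkinOf t ≡ just x → (x ≡ prefN t) ⊎ (x ≡ otherN t × claimed (claimedBefore t) (prefN t) ≡ true)
    napkinOf-just t x e with claimed (claimedBefore t) (prefN t) | claimed (claimedBefore t) (otherN t)
    ... | false | _ = inj₁ (sym (just-injective e))
    ... | true | false = inj₂ (sym (just-injective e) , refl)
    ... | true | true with () ← e

    prefN-plus : ∀ u → sgn u ≡ plus → prefN u ≡ seat u
    prefN-plus u e = cong (λ s → prefNapkin N s (seat u)) e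
    prefN-minus : ∀ u → sgn u ≡ minus → prefN u ≡ predN (seat u)
    prefN-minus u e = cong (λ s → prefNapkin N s (seat u)) e
    otherN-plus : ∀ u → sgn u ≡ plus → otherN u ≡ predN (seat u)
    otherN-plus u e = cong (λ s → otherNapkin N s (seat u)) e
    otherN-minus : ∀ u → sgn u ≡ minus → otherN u ≡ seat u
    otherN-minus u e = cong (λ s → otherNapkin N s (seat u)) e

    sgn-cases : ∀ u → (sgn u ≡ plus) ⊎ (sgn u ≡ minus)
    sgn-cases u with sgn u
    ... | plus = inj₁ refl
    ... | minus = inj₂ refl

    napkinOf-adjacent : ∀ t x → napkinOf t ≡ just x → (x ≡ seat t) ⊎ (x ≡ predN (seat t))
    napkinOf-adjacent t x e with napkinOf-just t x e | sgn-cases t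
    ... | inj₁ p | inj₁ s = inj₁ (trans p (prefN-plus t s))
    ... | inj₁ p | inj₂ s = inj₂ (trans p (prefN-minus t s))
    ... | inj₂ (o , _) | inj₁ s = inj₂ (trans o (otherN-plus t s))
    ... | inj₂ (o , _) | inj₂ s = inj₁ (trans o (otherN-minus t s))

    seat-< : ∀ t → seat t < N
    seat-< t = toℕ<n _
    dinerAt-< : ∀ s → dinerAt s < N
    dinerAt-< s = toℕ<n _

    dinerAt-seat : ∀ t → t < N → dinerAt (seat t) ≡ t
    dinerAt-seat t lt = trans (cong (λ i → toℕ (w ⟨$⟩ʳ i)) (clamp-toℕ (suc n₁) (w ⟨$⟩ˡ fin t)))
                     (trans (cong toℕ (inverseʳ w)) (toℕ-clamp (suc n₁) t (≤-pred lt)))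
    seat-dinerAt : ∀ s → s < N → seat (dinerAt s) ≡ s
    seat-dinerAt s lt = trans (cong (λ i → toℕ (w ⟨$⟩ˡ i)) (clamp-toℕ (suc n₁) (w ⟨$⟩ʳ fin s)))
                     (trans (cong toℕ (inverseˡ w)) (toℕ-clamp (suc n₁) s (≤-pred lt)))
    seat-inj : ∀ u v → u < N → v < N → seat u ≡ seat v → u ≡ v
    seat-inj u v lu lv e = trans (sym (dinerAt-seat u lu)) (trans (cong dinerAt e) (dinerAt-seat v lv))

    napkinless⇒ : ∀ t → napkinless t ≡ true → napkinOf t ≡ nothing
    napkinless⇒ t e with napkinOf t
    ... | nothing = refl
    ... | just _ with () ← e
    tookLeft⇒ : ∀ t → tookLeft t ≡ true → Σ ℕ (λ x → napkinOf t ≡ just x × x ≢ seat t)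
    tookLeft⇒ t e with napkinOf t
    ... | nothing with () ← e
    ... | just x = x , refl , λ { refl → case trans (sym e) (cong not (≡ᵇ-refl x)) of λ () }
    tookRight⇒ : ∀ t → tookRight t ≡ true → napkinOf t ≡ just (seat t)
    tookRight⇒ t e with napkinOf t
    ... | nothing with () ← e
    ... | just x = cong just (≡ᵇ-true e)
    ⇒tookLeft : ∀ t x → napkinOf t ≡ just x → x ≢ seat t → tookLeft t ≡ true
    ⇒tookLeft t x e ne with napkinOf t
    ⇒tookLeft t x refl ne | just .x = cong not (≢→≡ᵇ ne)
    ⇒tookRight : ∀ t → napkinOf t ≡ just (seat t) → tookRight t ≡ true
    ⇒tookRight t e with napkinOf t
    ⇒tookRight t refl | just .(seat t) = ≡ᵇ-refl (seat t)
    napkinless⇒¬tookLeft : ∀ t → napkinless t ≡ true → tookLeft t ≡ false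
    napkinless⇒¬tookLeft t e with napkinOf t
    ... | nothing = refl
    ... | just _ with () ← e
    napkinless⇒¬tookRight : ∀ t → napkinless t ≡ true → tookRight t ≡ false
    napkinless⇒¬tookRight t e with napkinOf t
    ... | nothing = refl
    ... | just _ with () ← e
    tookLeft⇒¬tookRight : ∀ t → tookLeft t ≡ true → tookRight t ≡ false
    tookLeft⇒¬tookRight t e with napkinOf t
    ... | nothing = refl
    ... | just x with x ≡ᵇ seat t
    ...   | true with () ← e
    ...   | false = refl

    rightNapkinOwner : ∀ u v → u < N → v < N → v ≢ u → napkinOf v ≡ just (seat u) → tookLeft v ≡ true × seat v ≡ succN (seat u)
    rightNapkinOwner u v lu lv ne g with napkinOf-adjacent v (seat u) g
    ... | inj₁ e = ⊥-elim (ne (seat-inj v u lv lu (sym e)))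
    ... | inj₂ e = ⇒tookLeft v (seat u) g (λ e' → ne (seat-inj v u lv lu (sym e'))) ,
                   trans (sym (succN-predN (seat v) (seat-< v))) (cong succN (sym e))

    leftNapkinOwner : ∀ u v → u < N → v < N → v ≢ u → napkinOf v ≡ just (predN (seat u)) →
        tookRight v ≡ true × seat v ≡ predN (seat u)
    leftNapkinOwner u v lu lv ne g with napkinOf-adjacent v (predN (seat u)) g
    ... | inj₁ e = ⇒tookRight v (subst (λ z → napkinOf v ≡ just z) e g) , sym e
    ... | inj₂ e = ⊥-elim (ne (seat-inj v u lv lu (sym (predN-injective _ _ (seat-< u) (seat-< v) e))))

    claimedRight⇒ : ∀ u → u < N → claimed (claimedBefore u) (seat u) ≡ true →
               tookLeft (dinerAt (succN (seat u))) ≡ true × dinerAt (succN (seat u)) < u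
    claimedRight⇒ u lu c with claimed⇒napkinOf u (seat u) c
    ... | (v , v<u , g) with rightNapkinOwner u v lu (<-trans v<u lu) (λ e → <-irrefl e v<u) g
    ...   | (l , e) rewrite sym e | dinerAt-seat v (<-trans v<u lu) = l , v<u

    claimedLeft⇒ : ∀ u → u < N → claimed (claimedBefore u) (predN (seat u)) ≡ true →
               tookRight (dinerAt (predN (seat u))) ≡ true × dinerAt (predN (seat u)) < u
    claimedLeft⇒ u lu c with claimed⇒napkinOf u (predN (seat u)) c
    ... | (v , v<u , g) with leftNapkinOwner u v lu (<-trans v<u lu) (λ e → <-irrefl e v<u) g
    ...   | (r , e) rewrite sym e | dinerAt-seat v (<-trans v<u lu) = r , v<u

    napkinless-claims : ∀ u → napkinOf u ≡ nothing →
        claimed (claimedBefore u) (seat u) ≡ true × claimed (claimedBefore u) (predN (seat u)) ≡ true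
    napkinless-claims u g with napkinOf-nothing u g | sgn-cases u
    ... | (cp , co) | inj₁ s = subst (λ z → claimed (claimedBefore u) z ≡ true) (prefN-plus u s) cp , subst (λ z → claimed (claimedBefore u) z ≡ true) (otherN-plus u s) co
    ... | (cp , co) | inj₂ s = subst (λ z → claimed (claimedBefore u) z ≡ true) (otherN-minus u s) co , subst (λ z → claimed (claimedBefore u) z ≡ true) (prefN-minus u s) cp

    tookLeft-plus-claims : ∀ u → tookLeft u ≡ true → sgn u ≡ plus → claimed (claimedBefore u) (seat u) ≡ true
    tookLeft-plus-claims u l s with tookLeft⇒ u l
    ... | (x , g , ne) with napkinOf-just u x g
    ...   | inj₁ e = ⊥-elim (ne (trans e (prefN-plus u s)))
    ...   | inj₂ (_ , c) = subst (λ z → claimed (claimedBefore u) z ≡ true) (prefN-plus u s) c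

    tookRight-minus-claims : ∀ u → tookRight u ≡ true → sgn u ≡ minus → claimed (claimedBefore u) (predN (seat u)) ≡ true
    tookRight-minus-claims u r s with napkinOf-just u (seat u) (tookRight⇒ u r)
    ... | inj₁ e = ⊥-elim (predN-≢ (seat u) (sym (trans e (prefN-minus u s))))
    ... | inj₂ (_ , c) = subst (λ z → claimed (claimedBefore u) z ≡ true) (prefN-minus u s) c

    sgn-signOf : ∀ t → t < N → sgn t ≡ signOf σ t
    sgn-signOf t lt = lookup-clamp (suc n₁) σ t (≤-pred lt)

    napkinless-rightNeighbour : ∀ s → s < N → napkinless (dinerAt s) ≡ true →
        tookLeft (dinerAt (succN s)) ≡ true × dinerAt (succN s) < dinerAt s
    napkinless-rightNeighbour s ls x with claimedRight⇒ (dinerAt s) (dinerAt-< s) (proj₁ (napkinless-claims (dinerAt s) (napkinless⇒ (dinerAt s) x)))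
    ... | r rewrite seat-dinerAt s ls = r
    napkinless-leftNeighbour : ∀ s → s < N → napkinless (dinerAt s) ≡ true →
        tookRight (dinerAt (predN s)) ≡ true × dinerAt (predN s) < dinerAt s
    napkinless-leftNeighbour s ls x with claimedLeft⇒ (dinerAt s) (dinerAt-< s) (proj₂ (napkinless-claims (dinerAt s) (napkinless⇒ (dinerAt s) x)))
    ... | r rewrite seat-dinerAt s ls = r
    tookLeft-plus-rightNeighbour : ∀ s → s < N → tookLeft (dinerAt s) ≡ true → sgn (dinerAt s) ≡ plus →
        tookLeft (dinerAt (succN s)) ≡ true × dinerAt (succN s) < dinerAt s
    tookLeft-plus-rightNeighbour s ls l p with claimedRight⇒ (dinerAt s) (dinerAt-< s) (tookLeft-plus-claims (dinerAt s) l p)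
    ... | r rewrite seat-dinerAt s ls = r
    tookRight-minus-leftNeighbour : ∀ s → s < N → tookRight (dinerAt s) ≡ true → sgn (dinerAt s) ≡ minus →
        tookRight (dinerAt (predN s)) ≡ true × dinerAt (predN s) < dinerAt s
    tookRight-minus-leftNeighbour s ls r m with claimedLeft⇒ (dinerAt s) (dinerAt-< s) (tookRight-minus-claims (dinerAt s) r m)
    ... | q rewrite seat-dinerAt s ls = q

    module BySucc = PermutationFrom (suc n₁) predN succN predN-< succN-< succN-predN predN-succN
    module ByPred = PermutationFrom (suc n₁) succN predN succN-< predN-< predN-succN succN-predN
    module BySeat = PermutationFrom (suc n₁) seat dinerAt (λ s _ → seat-< s) (λ s _ → dinerAt-< s) dinerAt-seat seat-dinerAt

    napkinlessAt : ℕ → ℕ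
    napkinlessAt s = ι (napkinless (dinerAt s))

    ν≡ΣN-seats : ν w σ ≡ ΣN N napkinlessAt
    ν≡ΣN-seats = trans ν-count (sym (BySeat.ΣN-reindex (λ t → ι (napkinless t))))

    3ν≤n : 3 * ν w σ ≤ N
    3ν≤n = subst (λ z → 3 * z ≤ N) (sym ν≡ΣN-seats) (NapkinlessCharging.3*ΣX≤n N succN predN BySucc.ΣN-reindex ByPred.ΣN-reindex
        (λ s → tookLeft (dinerAt s)) (λ s → tookRight (dinerAt s)) (λ s → napkinless (dinerAt s))
        succN-predN predN-succN
        (λ s ls x → proj₁ (napkinless-rightNeighbour s ls x) , proj₁ (napkinless-leftNeighbour s ls x))
        (λ s _ x → napkinless⇒¬tookLeft (dinerAt s) x) (λ s _ x → napkinless⇒¬tookRight (dinerAt s) x) (λ s _ l → tookLeft⇒¬tookRight (dinerAt s) l))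

    module ChargingPlus (k : ℕ) = PrefixCharging N succN BySucc.ΣN-reindex (λ s → napkinless (dinerAt s)) (λ s → tookLeft (dinerAt s))
        (λ s → dinerAt s <ᵇ k) (λ s → isPlus (sgn (dinerAt s)))
        (λ s ls x → proj₁ (napkinless-rightNeighbour s ls x) , λ e → <ᵇ-downward k (proj₂ (napkinless-rightNeighbour s ls x)) e)
        (λ s ls l p → proj₁ (tookLeft-plus-rightNeighbour s ls l (isPlus-true p)) , λ e → <ᵇ-downward k (proj₂ (tookLeft-plus-rightNeighbour s ls l (isPlus-true p))) e)
        (λ s _ x → napkinless⇒¬tookLeft (dinerAt s) x)

    module ChargingMinus (k : ℕ) = PrefixCharging N predN ByPred.ΣN-reindex (λ s → napkinless (dinerAt s)) (λ s → tookRight (dinerAt s))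
        (λ s → dinerAt s <ᵇ k) (λ s → not (isPlus (sgn (dinerAt s))))
        (λ s ls x → proj₁ (napkinless-leftNeighbour s ls x) , λ e → <ᵇ-downward k (proj₂ (napkinless-leftNeighbour s ls x)) e)
        (λ s ls r p → proj₁ (tookRight-minus-leftNeighbour s ls r (not-isPlus-true p)) , λ e → <ᵇ-downward k (proj₂ (tookRight-minus-leftNeighbour s ls r (not-isPlus-true p))) e)
        (λ s _ x → napkinless⇒¬tookRight (dinerAt s) x)

    inPrefix : ℕ → (Sign → Bool) → ℕ → ℕ
    inPrefix k p s = ι ((dinerAt s <ᵇ k) ∧ p (sgn (dinerAt s)))

    count-bySeat : ∀ k (p : Sign → Bool) → k ≤ N → ΣN N (inPrefix k p) ≡ ΣN k (λ t → ι (p (signOf σ t)))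
    count-bySeat k p k≤N = trans (BySeat.ΣN-reindex (λ t → ι ((t <ᵇ k) ∧ p (sgn t))))
                       (trans (ΣN-prefix N k (λ t → p (sgn t)) k≤N)
                              (ΣN-cong k (λ t t<k → cong (λ z → ι (p z)) (sgn-signOf t (<-≤-trans t<k k≤N)))))

    prefix-bound-plus : ∀ k → k ≤ N → plusCount σ k + 2 * ν w σ ≤ N + minusCount σ k
    prefix-bound-plus k k≤N = begin
        plusCount σ k + 2 * ν w σ                    ≡⟨ cong₂ (λ a v → a + 2 * v) (sym (count-bySeat k isPlus k≤N)) ν≡ΣN-seats ⟩
        ΣN N (inPrefix k isPlus) + 2 * ΣN N napkinlessAt ≤⟨ ChargingPlus.prefix-charging k ⟩
        N + ΣN N (inPrefix k (λ z → not (isPlus z)))  ≡⟨ cong (N +_) (count-bySeat k (λ z → not (isPlus z)) k≤N) ⟩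
        N + minusCount σ k                           ∎
      where open ≤-Reasoning

    prefix-bound-minus : ∀ k → k ≤ N → minusCount σ k + 2 * ν w σ ≤ N + plusCount σ k
    prefix-bound-minus k k≤N = begin
        minusCount σ k + 2 * ν w σ
          ≡⟨ cong₂ (λ a v → a + 2 * v) (sym (count-bySeat k (λ z → not (isPlus z)) k≤N)) ν≡ΣN-seats ⟩
        ΣN N (inPrefix k (λ z → not (isPlus z))) + 2 * ΣN N napkinlessAt
          ≤⟨ ChargingMinus.prefix-charging k ⟩
        N + ΣN N (inPrefix k (λ z → not (not (isPlus z))))
          ≡⟨ cong (N +_) (ΣN-cong N (λ s _ → cong (λ b → ι ((dinerAt s <ᵇ k) ∧ b)) (not-involutive (isPlus (sgn (dinerAt s)))))) ⟩
        N + ΣN N (inPrefix k isPlus)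
          ≡⟨ cong (N +_) (count-bySeat k isPlus k≤N) ⟩
        N + plusCount σ k ∎
      where open ≤-Reasoning

    napkinOf-free : ∀ t → claimed (claimedBefore t) (prefN t) ≡ false → napkinOf t ≡ just (prefN t)
    napkinOf-free t e with claimed (claimedBefore t) (prefN t)
    napkinOf-free t refl | false = refl

    claimed-both⇒napkinOf-nothing : ∀ t → claimed (claimedBefore t) (seat t) ≡ true →
        claimed (claimedBefore t) (predN (seat t)) ≡ true →
                                    napkinOf t ≡ nothing
    claimed-both⇒napkinOf-nothing t c1 c2 with sgn-cases t
    ... | inj₁ s with claimed (claimedBefore t) (prefN t) in e1 | claimed (claimedBefore t) (otherN t) in e2
    ...   | true | true = refl
    ...   | false | _ with () ← trans (sym e1) (trans (cong (claimed (claimedBefore t)) (prefN-plus t s)) c1)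
    ...   | true | false with () ← trans (sym e2) (trans (cong (claimed (claimedBefore t)) (otherN-plus t s)) c2)
    claimed-both⇒napkinOf-nothing t c1 c2 | inj₂ s with claimed (claimedBefore t) (prefN t) in e1 | claimed (claimedBefore t) (otherN t) in e2
    ...   | true | true = refl
    ...   | false | _ with () ← trans (sym e1) (trans (cong (claimed (claimedBefore t)) (prefN-minus t s)) c2)
    ...   | true | false with () ← trans (sym e2) (trans (cong (claimed (claimedBefore t)) (otherN-minus t s)) c1)

    napkinOf-nothing⇒napkinless : ∀ t → napkinOf t ≡ nothing → napkinless t ≡ true
    napkinOf-nothing⇒napkinless t g with napkinOf t
    napkinOf-nothing⇒napkinless t refl | nothing = refl

    napkinless-centre : ∀ a x b → a < N → x < N → b < N → seat a ≡ predN (seat x) → seat b ≡ succN (seat x) →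
             sgn a ≡ plus → sgn b ≡ minus → a < x → b < x → napkinless x ≡ true
    napkinless-centre a x b la lx lb sa sb pa mb a<x b<x = napkinOf-nothing⇒napkinless x (claimed-both⇒napkinOf-nothing x cR cL)
      where
      sa' : succN (seat a) ≡ seat x
      sa' = trans (cong succN sa) (succN-predN (seat x) (seat-< x))
      sb' : predN (seat b) ≡ seat x
      sb' = trans (cong predN sb) (predN-succN (seat x) (seat-< x))
      freeA : claimed (claimedBefore a) (prefN a) ≡ false
      freeA with claimed (claimedBefore a) (prefN a) in e
      ... | false = refl
      ... | true with claimedRight⇒ a la (subst (λ z → claimed (claimedBefore a) z ≡ true) (prefN-plus a pa) e)
      ...   | (_ , lt) rewrite sa' | dinerAt-seat x lx = ⊥-elim (<-asym lt a<x)
      freeB : claimed (claimedBefore b) (prefN b) ≡ false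
      freeB with claimed (claimedBefore b) (prefN b) in e
      ... | false = refl
      ... | true with claimedLeft⇒ b lb (subst (λ z → claimed (claimedBefore b) z ≡ true) (prefN-minus b mb) e)
      ...   | (_ , lt) rewrite sb' | dinerAt-seat x lx = ⊥-elim (<-asym lt b<x)
      cL : claimed (claimedBefore x) (predN (seat x)) ≡ true
      cL = napkinOf⇒claimed x a (predN (seat x)) a<x (trans (napkinOf-free a freeA) (cong just (trans (prefN-plus a pa) sa)))
      cR : claimed (claimedBefore x) (seat x) ≡ true
      cR = napkinOf⇒claimed x b (seat x) b<x (trans (napkinOf-free b freeB) (cong just (trans (prefN-minus b mb) sb')))


module Drift where

  open import Data.Nat as ℕ using (ℕ; zero; suc; z≤n; s≤s)
  import Data.Nat.Properties as ℕP
  open import Data.Integer as ℤ using (ℤ; +_; -[1+_]; _⊖_; +≤+; ∣_∣)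
  open import Data.Integer.Properties as ℤP using (⊔-lub; i≤i⊔j; i≤j⊔i; distribʳ-⊖-+-pos; distribʳ-⊖-+-neg; ⊖-monoˡ-≤; drop‿+≤+; 0≤i⇒+∣i∣≡i)
  open import Data.List using (List; []; _∷_; take; applyUpTo; foldr; length; map)
  open import Data.Vec using (Vec; toList)
  import Data.Vec as Vec
  open import Data.Vec.Properties using (toList-map; length-toList)
  open import Data.Bool using (not)
  open import Data.Bool.Properties using (not-involutive)
  open import Data.Sum using (_⊎_; inj₁; inj₂)
  open import Relation.Binary.PropositionalEquality
  open import Defs
  open Sums
  open Signs

  nth : List Sign → ℕ → Sign
  nth [] _ = plus
  nth (x ∷ l) zero = x
  nth (x ∷ l) (suc t) = nth l t

  plusCountL minusCountL : List Sign → ℕ → ℕ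
  plusCountL l k = ΣN k (λ t → ι (isPlus (nth l t)))
  minusCountL l k = ΣN k (λ t → ι (not (isPlus (nth l t))))

  sumS-take : ∀ l k → k ℕ.≤ length l → sumS (take k l) ≡ plusCountL l k ⊖ minusCountL l k
  sumS-take l zero _ = refl
  sumS-take (plus ∷ l) (suc k) (s≤s le) = begin
      + 1 ℤ.+ sumS (take k l) ≡⟨ cong (λ z → (+ 1) ℤ.+ z) (sumS-take l k le) ⟩
      + 1 ℤ.+ (plusCountL l k ⊖ minusCountL l k) ≡⟨ distribʳ-⊖-+-pos 1 (plusCountL l k) (minusCountL l k) ⟩
      suc (plusCountL l k) ⊖ minusCountL l k ≡⟨ sym (cong₂ _⊖_ (ΣN-front k (λ t → ι (isPlus (nth (plus ∷ l) t)))) (ΣN-front k (λ t → ι (not (isPlus (nth (plus ∷ l) t)))))) ⟩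
      plusCountL (plus ∷ l) (suc k) ⊖ minusCountL (plus ∷ l) (suc k) ∎
    where open ≡-Reasoning
  sumS-take (minus ∷ l) (suc k) (s≤s le) = begin
      -[1+ 0 ] ℤ.+ sumS (take k l) ≡⟨ cong (λ z → -[1+ 0 ] ℤ.+ z) (sumS-take l k le) ⟩
      -[1+ 0 ] ℤ.+ (plusCountL l k ⊖ minusCountL l k) ≡⟨ distribʳ-⊖-+-neg 0 (plusCountL l k) (minusCountL l k) ⟩
      plusCountL l k ⊖ suc (minusCountL l k) ≡⟨ sym (cong₂ _⊖_ (ΣN-front k (λ t → ι (isPlus (nth (minus ∷ l) t)))) (ΣN-front k (λ t → ι (not (isPlus (nth (minus ∷ l) t)))))) ⟩
      plusCountL (minus ∷ l) (suc k) ⊖ minusCountL (minus ∷ l) (suc k) ∎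
    where open ≡-Reasoning

  foldr-⊔-≤ : ∀ m (f : ℕ → ℤ) c → (∀ i → i ℕ.< m → f i ℤ.≤ + c) → foldr ℤ._⊔_ (+ 0) (applyUpTo f m) ℤ.≤ + c
  foldr-⊔-≤ zero f c h = +≤+ z≤n
  foldr-⊔-≤ (suc m) f c h = ⊔-lub (h 0 (s≤s z≤n)) (foldr-⊔-≤ m (λ i → f (suc i)) c (λ i lt → h (suc i) (s≤s lt)))

  foldr-⊔-≥0 : ∀ m (f : ℕ → ℤ) → + 0 ℤ.≤ foldr ℤ._⊔_ (+ 0) (applyUpTo f m)
  foldr-⊔-≥0 zero f = +≤+ z≤n
  foldr-⊔-≥0 (suc m) f = ℤP.≤-trans (foldr-⊔-≥0 m (λ i → f (suc i))) (i≤j⊔i (f 0) _)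

  foldr-⊔-≥ : ∀ m (f : ℕ → ℤ) i → i ℕ.< m → f i ℤ.≤ foldr ℤ._⊔_ (+ 0) (applyUpTo f m)
  foldr-⊔-≥ (suc m) f zero _ = i≤i⊔j (f 0) _
  foldr-⊔-≥ (suc m) f (suc i) (s≤s lt) = ℤP.≤-trans (foldr-⊔-≥ m (λ j → f (suc j)) i lt) (i≤j⊔i (f 0) _)

  driftℤ-≥0 : ∀ l → + 0 ℤ.≤ driftℤ l
  driftℤ-≥0 l = foldr-⊔-≥0 (length l) _

  ∣driftℤ∣≤ : ∀ l c → (∀ i → i ℕ.≤ length l → plusCountL l i ℕ.≤ c ℕ.+ minusCountL l i) → ∣ driftℤ l ∣ ℕ.≤ c
  ∣driftℤ∣≤ l c h = drop‿+≤+ (subst (ℤ._≤ + c) (sym (0≤i⇒+∣i∣≡i (driftℤ-≥0 l)))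
     (foldr-⊔-≤ (length l) _ c (λ i lt → subst (ℤ._≤ + c) (sym (sumS-take l (suc i) lt))
        (ℤP.≤-trans (⊖-monoˡ-≤ (minusCountL l (suc i)) (h (suc i) lt)) (ℤP.≤-reflexive (m+n⊖n (minusCountL l (suc i))))))))
    where
    m+n⊖n : ∀ n → c ℕ.+ n ⊖ n ≡ + c
    m+n⊖n n = trans (cong (_⊖ n) (ℕP.+-comm c n)) (trans (ℤP.⊖-≥ (ℕP.m≤m+n n c)) (cong +_ (ℕP.m+n∸m≡n n c)))

  prefix≤driftℤ : ∀ l i → i ℕ.≤ length l → plusCountL l i ℕ.≤ ∣ driftℤ l ∣ ℕ.+ minusCountL l i
  prefix≤driftℤ l zero _ = z≤n
  prefix≤driftℤ l (suc i) lt with foldr-⊔-≥ (length l) (λ j → sumS (take (suc j) l)) i lt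
  ... | le = conv (subst₂ ℤ._≤_ (sumS-take l (suc i) lt) (sym (0≤i⇒+∣i∣≡i (driftℤ-≥0 l))) le)
    where
    conv : ∀ {P M d} → P ⊖ M ℤ.≤ + d → P ℕ.≤ d ℕ.+ M
    conv {P} {M} {d} le' with ℕP.≤-total M P
    ... | inj₁ M≤P = ℕP.≤-trans (ℕP.≤-reflexive (sym (ℕP.m∸n+n≡m M≤P)))
                       (ℕP.+-monoˡ-≤ M (drop‿+≤+ (subst (ℤ._≤ + d) (ℤP.⊖-≥ M≤P) le')))
    ... | inj₂ P≤M = ℕP.≤-trans P≤M (ℕP.m≤n+m M d)

  signOf-nth : ∀ {n} (σ : Vec Sign n) t → signOf σ t ≡ nth (toList σ) t
  signOf-nth Vec.[] t = refl
  signOf-nth (x Vec.∷ σ) zero = refl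
  signOf-nth (x Vec.∷ σ) (suc t) = signOf-nth σ t

  plusCount-toList : ∀ {n} (σ : Vec Sign n) k → plusCount σ k ≡ plusCountL (toList σ) k
  plusCount-toList σ k = ΣN-cong k (λ t _ → cong (λ z → ι (isPlus z)) (signOf-nth σ t))
  minusCount-toList : ∀ {n} (σ : Vec Sign n) k → minusCount σ k ≡ minusCountL (toList σ) k
  minusCount-toList σ k = ΣN-cong k (λ t _ → cong (λ z → ι (not (isPlus z))) (signOf-nth σ t))

  nth-map-flipS : ∀ l t → t ℕ.< length l → nth (map flipS l) t ≡ flipS (nth l t)
  nth-map-flipS (x ∷ l) zero _ = refl
  nth-map-flipS (x ∷ l) (suc t) (s≤s lt) = nth-map-flipS l t lt

  plusCount-negσ : ∀ {n} (σ : Vec Sign n) k → k ℕ.≤ n → plusCountL (toList (negσ σ)) k ≡ minusCount σ k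
  plusCount-negσ {n} σ k le = ΣN-cong k (λ t lt → trans (cong (λ l → ι (isPlus (nth l t))) (toList-map flipS σ))
      (trans (cong (λ z → ι (isPlus z)) (nth-map-flipS (toList σ) t (subst (t ℕ.<_) (sym (length-toList σ)) (ℕP.<-≤-trans lt le))))
       (trans (cong ι (isPlus-flipS _)) (cong (λ z → ι (not (isPlus z))) (sym (signOf-nth σ t))))))

  minusCount-negσ : ∀ {n} (σ : Vec Sign n) k → k ℕ.≤ n → minusCountL (toList (negσ σ)) k ≡ plusCount σ k
  minusCount-negσ {n} σ k le = ΣN-cong k (λ t lt → trans (cong (λ l → ι (not (isPlus (nth l t)))) (toList-map flipS σ))
      (trans (cong (λ z → ι (not (isPlus z))) (nth-map-flipS (toList σ) t (subst (t ℕ.<_) (sym (length-toList σ)) (ℕP.<-≤-trans lt le))))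
       (trans (cong (λ b → ι (not b)) (isPlus-flipS _)) (trans (cong ι (not-involutive _)) (cong (λ z → ι (isPlus z)) (sym (signOf-nth σ t)))))))

  drift≤ : ∀ {n} (σ : Vec Sign n) c → (∀ k → k ℕ.≤ n → plusCount σ k ℕ.≤ c ℕ.+ minusCount σ k) → drift σ ℕ.≤ c
  drift≤ {n} σ c h = ∣driftℤ∣≤ (toList σ) c (λ i le →
     let le' = subst (i ℕ.≤_) (length-toList σ) le in
     subst₂ (λ a b → a ℕ.≤ c ℕ.+ b) (plusCount-toList σ i) (minusCount-toList σ i) (h i le'))

  drift-negσ≤ : ∀ {n} (σ : Vec Sign n) c → (∀ k → k ℕ.≤ n → minusCount σ k ℕ.≤ c ℕ.+ plusCount σ k) → drift (negσ σ) ℕ.≤ c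
  drift-negσ≤ {n} σ c h = ∣driftℤ∣≤ (toList (negσ σ)) c (λ i le →
     let le' = subst (i ℕ.≤_) (length-toList (negσ σ)) le in
     subst₂ (λ a b → a ℕ.≤ c ℕ.+ b) (sym (plusCount-negσ σ i le')) (sym (minusCount-negσ σ i le')) (h i le'))

  prefix≤drift : ∀ {n} (σ : Vec Sign n) k → k ℕ.≤ n → plusCount σ k ℕ.≤ drift σ ℕ.+ minusCount σ k
  prefix≤drift σ k le = subst₂ (λ a b → a ℕ.≤ drift σ ℕ.+ b) (sym (plusCount-toList σ k)) (sym (minusCount-toList σ k))
     (prefix≤driftℤ (toList σ) k (subst (k ℕ.≤_) (sym (length-toList σ)) le))

  prefix≤drift-negσ : ∀ {n} (σ : Vec Sign n) k → k ℕ.≤ n → minusCount σ k ℕ.≤ drift (negσ σ) ℕ.+ plusCount σ k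
  prefix≤drift-negσ σ k le = subst₂ (λ a b → a ℕ.≤ drift (negσ σ) ℕ.+ b) (plusCount-negσ σ k le) (minusCount-negσ σ k le)
     (prefix≤driftℤ (toList (negσ σ)) k (subst (k ℕ.≤_) (sym (length-toList (negσ σ))) le))


module Arrangements where

  open import Data.Bool using (true; false; not; _∨_)
  open import Data.Nat
  open import Data.Nat.Properties
  open import Data.Product using (Σ; _×_; _,_; proj₁; proj₂)
  open import Data.Empty using (⊥-elim)
  open import Data.List using (_∷_; map; applyUpTo; findᵇ)
  open import Data.Maybe using (just; nothing)
  open import Relation.Nullary using (yes; no)
  open import Relation.Binary using (tri<; tri≈; tri>)
  open import Relation.Binary.PropositionalEquality
  open import Defs
  open Booleans

  findᵇ-first : ∀ m (f : ℕ → ℕ) p a → a < m → (∀ i → i < a → p (f i) ≡ false) → p (f a) ≡ true →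
               findᵇ p (applyUpTo f m) ≡ just (f a)
  findᵇ-first (suc m) f p zero _ _ pa rewrite pa = refl
  findᵇ-first (suc m) f p (suc a) (s≤s lt) h pa rewrite h 0 (s≤s z≤n) =
    findᵇ-first m (λ i → f (suc i)) p a lt (λ i lt' → h (suc i) (s≤s lt')) pa

  findᵇ-none : ∀ m (f : ℕ → ℕ) p → (∀ i → i < m → p (f i) ≡ false) → findᵇ p (applyUpTo f m) ≡ nothing
  findᵇ-none zero f p h = refl
  findᵇ-none (suc m) f p h rewrite h 0 (s≤s z≤n) = findᵇ-none m (λ i → f (suc i)) p (λ i lt → h (suc i) (s≤s lt))

  map-applyUpTo : ∀ (g f : ℕ → ℕ) m → map g (applyUpTo f m) ≡ applyUpTo (λ i → g (f i)) m
  map-applyUpTo g f zero = refl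
  map-applyUpTo g f (suc m) = cong (g (f 0) ∷_) (map-applyUpTo g (λ i → f (suc i)) m)

  module ChooseSeat (n : ℕ) (A : Arrangement) where
    choose-plus-left : ∀ j → findᵇ (λ j → not (assigned A (3 * j))) (benches n) ≡ just j → chooseSeat n A plus ≡ just (3 * j)
    choose-plus-left j e rewrite e = refl

    choose-plus-primed : ∀ s → findᵇ (λ j → not (assigned A (3 * j))) (benches n) ≡ nothing →
        primedSeat n A ≡ just s → chooseSeat n A plus ≡ just s
    choose-plus-primed s e1 e2 rewrite e1 | e2 = refl

    choose-plus-right : ∀ j → findᵇ (λ j → not (assigned A (3 * j))) (benches n) ≡ nothing → primedSeat n A ≡ nothing →
              findᵇ (λ j → not (assigned A (3 * j + 2))) (benches n) ≡ just j → chooseSeat n A plus ≡ just (3 * j + 2)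
    choose-plus-right j e1 e2 e3 rewrite e1 | e2 | e3 = refl

    choose-minus-right : ∀ j → findᵇ (λ j → not (assigned A (3 * j + 2))) (benches n) ≡ just j →
        chooseSeat n A minus ≡ just (3 * j + 2)
    choose-minus-right j e rewrite e = refl

    choose-minus-primed : ∀ s → findᵇ (λ j → not (assigned A (3 * j + 2))) (benches n) ≡ nothing →
        primedSeat n A ≡ just s → chooseSeat n A minus ≡ just s
    choose-minus-primed s e1 e2 rewrite e1 | e2 = refl

    choose-minus-left : ∀ j → findᵇ (λ j → not (assigned A (3 * j + 2))) (benches n) ≡ nothing → primedSeat n A ≡ nothing →
              findᵇ (λ j → not (assigned A (3 * j))) (benches n) ≡ just j → chooseSeat n A minus ≡ just (3 * j)
    choose-minus-left j e1 e2 e3 rewrite e1 | e2 | e3 = refl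

    primedSeat-bench : ∀ j → findᵇ (primed A) (benches n) ≡ just j → primedSeat n A ≡ just (3 * j + 1)
    primedSeat-bench j e rewrite e = refl

    primedSeat-remainder : findᵇ (primed A) (benches n) ≡ nothing →
               primedSeat n A ≡ findᵇ (λ r → not (assigned A r)) (remainderSeats n)
    primedSeat-remainder e rewrite e = refl

  assigned-assign : ∀ A S t k → assigned (assign A (just S) t) k ≡ ((k ≡ᵇ S) ∨ assigned A k)
  assigned-assign A S t k with k ≡ᵇ S
  ... | true = refl
  ... | false = refl

  assign-≢ : ∀ A S t k → k ≢ S → assign A (just S) t k ≡ A k
  assign-≢ A S t k ne rewrite ≢→≡ᵇ ne = refl

  assign-≡ : ∀ A S t → assign A (just S) t S ≡ just t
  assign-≡ A S t rewrite ≡ᵇ-refl S = refl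

  3j+k<3j' : ∀ j j' k → k < 3 → j < j' → 3 * j + k < 3 * j'
  3j+k<3j' j j' k k<3 j<j' = begin-strict
      3 * j + k <⟨ +-monoʳ-< (3 * j) k<3 ⟩
      3 * j + 3 ≡⟨ +-comm (3 * j) 3 ⟩
      3 + 3 * j ≡⟨ sym (*-suc 3 j) ⟩
      3 * suc j ≤⟨ *-monoʳ-≤ 3 j<j' ⟩
      3 * j' ∎
    where open ≤-Reasoning

  3*+-injective : ∀ j j' k k' → k < 3 → k' < 3 → 3 * j + k ≡ 3 * j' + k' → j ≡ j' × k ≡ k'
  3*+-injective j j' k k' k<3 k'<3 e with <-cmp j j'
  ... | tri< lt _ _ = ⊥-elim (<-irrefl e (<-≤-trans (3j+k<3j' j j' k k<3 lt) (m≤m+n (3 * j') k')))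
  ... | tri> _ _ gt = ⊥-elim (<-irrefl (sym e) (<-≤-trans (3j+k<3j' j' j k' k'<3 gt) (m≤m+n (3 * j) k)))
  ... | tri≈ _ refl _ = refl , +-cancelˡ-≡ (3 * j) k k' e

  assigned-assign-≢ : ∀ A S t k → k ≢ S → assigned (assign A (just S) t) k ≡ assigned A k
  assigned-assign-≢ A S t k ne rewrite assigned-assign A S t k | ≢→≡ᵇ ne = refl

  assigned-bump : ∀ A t (f : ℕ → ℕ) → (∀ a b → f a ≡ f b → a ≡ b) → ∀ j x →
          assigned A (f j) ≡ (j <ᵇ x) → assigned (assign A (just (f x)) t) (f j) ≡ (j <ᵇ suc x)
  assigned-bump A t f inj j x e rewrite assigned-assign A (f x) t (f j) with j ≟ x
  ... | yes refl rewrite ≡ᵇ-refl (f j) = sym (<→<ᵇ (n<1+n j))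
  ... | no ne rewrite ≢→≡ᵇ (λ q → ne (inj j x q)) = trans e (sym (<ᵇ-suc j x ne))

  3*+k-injective : ∀ k → k < 3 → ∀ a b → 3 * a + k ≡ 3 * b + k → a ≡ b
  3*+k-injective k k<3 a b e = proj₁ (3*+-injective a b k k k<3 k<3 e)

  3*-injective : ∀ a b → 3 * a ≡ 3 * b → a ≡ b
  3*-injective a b e = *-cancelˡ-≡ a b 3 e

  seat-≢-offset : ∀ j k x k' → k < 3 → k' < 3 → k ≢ k' → 3 * j + k ≢ 3 * x + k'
  seat-≢-offset j k x k' k< k'< ne e = ne (proj₂ (3*+-injective j x k k' k< k'< e))

  seat-≢-bench : ∀ j k x k' → k < 3 → k' < 3 → j ≢ x → 3 * j + k ≢ 3 * x + k'
  seat-≢-bench j k x k' k< k'< ne e = ne (proj₁ (3*+-injective j x k k' k< k'< e))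

  3*j≡3*j+0 : ∀ j → 3 * j ≡ 3 * j + 0
  3*j≡3*j+0 j = sym (+-identityʳ _)

  leftmost≢offset : ∀ j x k' → 0 < k' → k' < 3 → 3 * j ≢ 3 * x + k'
  leftmost≢offset j x k' 0<k' k'< e = seat-≢-offset j 0 x k' (s≤s z≤n) k'< (λ e' → <-irrefl e' 0<k') (trans (sym (3*j≡3*j+0 j)) e)

  offset≢leftmost : ∀ j x k → 0 < k → k < 3 → 3 * j + k ≢ 3 * x
  offset≢leftmost j x k 0<k k< e = leftmost≢offset x j k 0<k k< (sym e)

  leftmost-≢ : ∀ j x → j ≢ x → 3 * j ≢ 3 * x
  leftmost-≢ j x ne e = ne (3*-injective j x e)

  assigned⇒just : ∀ (A : Arrangement) s → assigned A s ≡ true → Σ ℕ (λ a → A s ≡ just a)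
  assigned⇒just A s e with A s
  ... | just a = a , refl
  unassigned⇒nothing : ∀ (A : Arrangement) s → assigned A s ≡ false → A s ≡ nothing
  unassigned⇒nothing A s e with A s
  ... | nothing = refl

  [1+m]⊓n≤1+[m⊓n] : ∀ a b → suc a ⊓ b ≤ suc (a ⊓ b)
  [1+m]⊓n≤1+[m⊓n] a zero = z≤n
  [1+m]⊓n≤1+[m⊓n] a (suc b) = s≤s (≤-trans (⊓-monoʳ-≤ a (n≤1+n b)) ≤-refl)

  m<n⇒[1+m]⊓n≡1+[m⊓n] : ∀ a b → a < b → suc a ⊓ b ≡ suc (a ⊓ b)
  m<n⇒[1+m]⊓n≡1+[m⊓n] a b lt rewrite m≤n⇒m⊓n≡m lt | m≤n⇒m⊓n≡m (<⇒≤ lt) = refl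

  n≤m⇒[1+m]⊓n≡m⊓n : ∀ a b → b ≤ a → suc a ⊓ b ≡ a ⊓ b
  n≤m⇒[1+m]⊓n≡m⊓n a b le rewrite m≥n⇒m⊓n≡n (m≤n⇒m≤1+n le) | m≥n⇒m⊓n≡n le = refl

  m⊓[1+n]≤1+[m⊓n] : ∀ a b → a ⊓ suc b ≤ suc (a ⊓ b)
  m⊓[1+n]≤1+[m⊓n] a b rewrite ⊓-comm a (suc b) | ⊓-comm a b = [1+m]⊓n≤1+[m⊓n] b a

  n<m⇒m⊓[1+n]≡1+[m⊓n] : ∀ a b → b < a → a ⊓ suc b ≡ suc (a ⊓ b)
  n<m⇒m⊓[1+n]≡1+[m⊓n] a b lt rewrite ⊓-comm a (suc b) | ⊓-comm a b = m<n⇒[1+m]⊓n≡1+[m⊓n] b a lt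

  m≤n⇒m⊓[1+n]≡m⊓n : ∀ a b → a ≤ b → a ⊓ suc b ≡ a ⊓ b
  m≤n⇒m⊓[1+n]≡m⊓n a b le rewrite ⊓-comm a (suc b) | ⊓-comm a b = n≤m⇒[1+m]⊓n≡m⊓n b a le


module AlgorithmC where

  open import Data.Bool using (Bool; true; false; not; _∧_; if_then_else_)
  open import Data.Bool.Properties using (∧-zeroʳ)
  open import Data.Nat
  open import Data.Nat.Properties
  open import Data.Nat.DivMod using (m≡m%n+[m/n]*n; m%n≡m∸m/n*n; m%n<n)
  open import Data.Product using (Σ; _×_; _,_; proj₁; proj₂; ∃)
  open import Data.Sum using (_⊎_; inj₁; inj₂)
  open import Data.Empty using (⊥; ⊥-elim)
  open import Data.List using (List; []; _∷_; map; applyUpTo; upTo; findᵇ)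
  open import Data.Maybe using (Maybe; just; nothing; is-just)
  open import Data.Vec using (Vec; toList)
  open import Data.Vec.Properties using (length-toList)
  open import Relation.Nullary using (yes; no)
  open import Function using (case_of_)
  open import Relation.Binary.PropositionalEquality
  open import Defs
  open Sums
  open Booleans
  open Signs
  open Arrangements
  open import Data.Nat.Tactic.RingSolver using (solve-∀)

  module Trace (n : ℕ) (σ : Vec Sign n) where
    q r : ℕ
    q = n / 3
    r = n ∸ 3 * q

    3q≤n : 3 * q ≤ n
    3q≤n = subst (_≤ n) (*-comm q 3) (subst (q * 3 ≤_) (sym (m≡m%n+[m/n]*n n 3)) (m≤n+m (q * 3) (n % 3)))

    n-eq : n ≡ 3 * q + r
    n-eq = sym (m+[n∸m]≡n 3q≤n)

    n≡q+q+q+r : n ≡ q + q + q + r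
    n≡q+q+q+r = trans n-eq (cong (_+ r) (sym (trans (+-assoc q q q) (cong (λ x → q + (q + x)) (sym (+-identityʳ q))))))

    r<3 : r < 3
    r<3 = subst (_< 3) (trans (m%n≡m∸m/n*n n 3) (cong (n ∸_) (*-comm q 3))) (m%n<n n 3)

    seat-decompose : ∀ s → s < n → (Σ ℕ λ j → Σ ℕ λ k → j < q × k < 3 × s ≡ 3 * j + k) ⊎ (Σ ℕ λ i → i < r × s ≡ 3 * q + i)
    seat-decompose s s<n with s / 3 <? q
    ... | yes lt = inj₁ (s / 3 , s % 3 , lt , m%n<n s 3 , trans (m≡m%n+[m/n]*n s 3) (trans (+-comm (s % 3) _) (cong (_+ s % 3) (*-comm (s / 3) 3))))
    ... | no nlt = inj₂ (s ∸ 3 * q , i<r , sym (m+[n∸m]≡n 3q≤s))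
      where
      3q≤s : 3 * q ≤ s
      3q≤s = ≤-trans (*-monoʳ-≤ 3 (≮⇒≥ nlt)) (≤-trans (≤-reflexive (*-comm 3 (s / 3))) (≤-trans (m≤n+m _ (s % 3)) (≤-reflexive (sym (m≡m%n+[m/n]*n s 3)))))
      i<r : s ∸ 3 * q < r
      i<r = +-cancelˡ-< (3 * q) _ _ (subst (_< 3 * q + r) (sym (m+[n∸m]≡n 3q≤s)) (subst (s <_) n-eq s<n))

    SignAt : Sign → Maybe ℕ → Set
    SignAt s (just a) = signOf σ a ≡ s
    SignAt s nothing = ⊥

    endsDiffer : Arrangement → ℕ → Bool
    endsDiffer A j with A (3 * j) | A (3 * j + 2)
    ... | just a | just b = differ (signOf σ a) (signOf σ b)
    ... | just _ | nothing = false
    ... | nothing | _ = false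

    endsDiffer-cong : ∀ A A' j → A' (3 * j) ≡ A (3 * j) → A' (3 * j + 2) ≡ A (3 * j + 2) → endsDiffer A' j ≡ endsDiffer A j
    endsDiffer-cong A A' j e1 e2 with A' (3 * j) | A' (3 * j + 2)
    endsDiffer-cong A A' j refl refl | _ | _ = refl

    endsDiffer-noLeft : ∀ A j → A (3 * j) ≡ nothing → endsDiffer A j ≡ false
    endsDiffer-noLeft A j e with A (3 * j)
    endsDiffer-noLeft A j refl | nothing = refl

    endsDiffer-noRight : ∀ A j → A (3 * j + 2) ≡ nothing → endsDiffer A j ≡ false
    endsDiffer-noRight A j e with A (3 * j) | A (3 * j + 2)
    endsDiffer-noRight A j refl | just _ | nothing = refl
    endsDiffer-noRight A j refl | nothing | nothing = refl

    endsDiffer-val : ∀ A j a b → A (3 * j) ≡ just a → A (3 * j + 2) ≡ just b → endsDiffer A j ≡ differ (signOf σ a) (signOf σ b)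
    endsDiffer-val A j a b e1 e2 with A (3 * j) | A (3 * j + 2)
    endsDiffer-val A j a b refl refl | _ | _ = refl

    -- k⁺ (k⁻) counts plus (minus) diners that rule (c) sent to a rightmost (leftmost) seat;
    -- c⁺ (c⁻) counts plus (minus) diners on centre or remainder seats.
    record Counters : Set where
      constructor counters
      field
        ℓ ρ c e k⁺ k⁻ c⁺ c⁻ : ℕ
        seatOf : ℕ → ℕ

    record Invariant (t : ℕ) (A : Arrangement) (G : Counters) : Set where
      open Counters G
      field
        t≤n : t ≤ n
        ℓ≤q : ℓ ≤ q
        ρ≤q : ρ ≤ q
        c≤ℓ : c ≤ ℓ
        c≤ρ : c ≤ ρ
        e≤r : e ≤ r
        leftmostFilled : ∀ j → j < q → assigned A (3 * j) ≡ (j <ᵇ ℓ)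
        centreFilled : ∀ j → j < q → assigned A (3 * j + 1) ≡ (j <ᵇ c)
        rightmostFilled : ∀ j → j < q → assigned A (3 * j + 2) ≡ (j <ᵇ ρ)
        remainderFilled : ∀ i → i < r → assigned A (3 * q + i) ≡ (i <ᵇ e)
        t≡ℓ+ρ+c+e : t ≡ ℓ + ρ + c + e
        plusTally : plusCount σ t + k⁻ ≡ ℓ + k⁺ + c⁺
        minusTally : minusCount σ t + k⁺ ≡ ρ + k⁻ + c⁻
        centreTally : c + e ≡ c⁺ + c⁻
        ℓ<q⇒k⁺≡c⁺≡0 : ℓ < q → k⁺ ≡ 0 × c⁺ ≡ 0
        ρ<q⇒k⁻≡c⁻≡0 : ρ < q → k⁻ ≡ 0 × c⁻ ≡ 0
        k⁺≡0⊎k⁻≡0 : k⁺ ≡ 0 ⊎ k⁻ ≡ 0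
        k⁺-drift : k⁺ ≡ 0 ⊎ Σ ℕ (λ k → k ≤ t × minusCount σ k + (q + r) + 2 * k⁺ ≤ plusCount σ k + 1)
        k⁻-drift : k⁻ ≡ 0 ⊎ Σ ℕ (λ k → k ≤ t × plusCount σ k + (q + r) + 2 * k⁻ ≤ minusCount σ k + 1)
        rightmostMinus : ℓ < q → ∀ j → j < ρ → SignAt minus (A (3 * j + 2))
        leftmostPlus : ρ < q → ∀ j → j < ℓ → SignAt plus (A (3 * j))
        noMinusPlusBench : ∀ j → j < ℓ → j < ρ → SignAt minus (A (3 * j)) → SignAt plus (A (3 * j + 2)) → ⊥
        differingEnds : ℓ ⊓ ρ ≤ ΣN q (λ j → ι (endsDiffer A j)) + k⁺ + k⁻
        centreLatest : ∀ j → j < c → Σ ℕ λ a → Σ ℕ λ x → Σ ℕ λ b →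
                A (3 * j) ≡ just a × A (3 * j + 1) ≡ just x × A (3 * j + 2) ≡ just b × a < x × b < x
        seatOf-assigned : ∀ u → u < t → A (seatOf u) ≡ just u
        seatOf-< : ∀ u → u < t → seatOf u < n
        assigned-seatOf : ∀ s u → A s ≡ just u → u < t × seatOf u ≡ s

    seatOf-update : (ℕ → ℕ) → ℕ → ℕ → ℕ → ℕ
    seatOf-update seatOf t S u = if u ≡ᵇ t then S else seatOf u

    module SeatOfUpdate (t : ℕ) (A : Arrangement) (seatOf : ℕ → ℕ) (S : ℕ)
      (free : A S ≡ nothing) (S<n : S < n)
      (seatOf-assigned : ∀ u → u < t → A (seatOf u) ≡ just u)
      (seatOf-< : ∀ u → u < t → seatOf u < n)
      (assigned-seatOf : ∀ s u → A s ≡ just u → u < t × seatOf u ≡ s) where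

      A' = assign A (just S) t

      seatOf-assigned′ : ∀ u → u < suc t → A' (seatOf-update seatOf t S u) ≡ just u
      seatOf-assigned′ u lt with u ≟ t
      ... | yes refl rewrite ≡ᵇ-refl u = assign-≡ A S u
      ... | no ne rewrite ≢→≡ᵇ ne = trans (assign-≢ A S t (seatOf u) (λ e → case trans (sym (seatOf-assigned u u<t)) (trans (cong A e) free) of λ ())) (seatOf-assigned u u<t)
        where u<t = ≤∧≢⇒< (≤-pred lt) ne

      seatOf-<′ : ∀ u → u < suc t → seatOf-update seatOf t S u < n
      seatOf-<′ u lt with u ≟ t
      ... | yes refl rewrite ≡ᵇ-refl u = S<n
      ... | no ne rewrite ≢→≡ᵇ ne = seatOf-< u (≤∧≢⇒< (≤-pred lt) ne)

      assigned-seatOf′ : ∀ s u → A' s ≡ just u → u < suc t × seatOf-update seatOf t S u ≡ s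
      assigned-seatOf′ s u e with s ≟ S
      ... | yes refl rewrite assign-≡ A s t with e
      ...   | refl rewrite ≡ᵇ-refl t = ≤-refl , refl
      assigned-seatOf′ s u e | no ne rewrite assign-≢ A S t s ne with assigned-seatOf s u e
      ...   | (u<t , sdu) rewrite ≢→≡ᵇ (<⇒≢ u<t) = m<n⇒m<1+n u<t , sdu

    counters₀ : Counters
    counters₀ = counters 0 0 0 0 0 0 0 0 (λ _ → 0)

    invariant₀ : Invariant 0 (λ _ → nothing) counters₀
    invariant₀ = record
      { t≤n = z≤n ; ℓ≤q = z≤n ; ρ≤q = z≤n ; c≤ℓ = z≤n ; c≤ρ = z≤n ; e≤r = z≤n
      ; leftmostFilled = λ _ _ → refl ; centreFilled = λ _ _ → refl ; rightmostFilled = λ _ _ → refl ; remainderFilled = λ _ _ → refl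
      ; t≡ℓ+ρ+c+e = refl ; plusTally = refl ; minusTally = refl ; centreTally = refl
      ; ℓ<q⇒k⁺≡c⁺≡0 = λ _ → refl , refl ; ρ<q⇒k⁻≡c⁻≡0 = λ _ → refl , refl ; k⁺≡0⊎k⁻≡0 = inj₁ refl
      ; k⁺-drift = inj₁ refl ; k⁻-drift = inj₁ refl
      ; rightmostMinus = λ _ j () ; leftmostPlus = λ _ j () ; noMinusPlusBench = λ j () ; differingEnds = z≤n
      ; centreLatest = λ j () ; seatOf-assigned = λ u () ; seatOf-< = λ u () ; assigned-seatOf = λ s u () }

    seat<n : ∀ j k → j < q → k < 3 → 3 * j + k < n
    seat<n j k j<q k<3 = <-≤-trans (3j+k<3j' j q k k<3 j<q) 3q≤n

    remainder<n : ∀ i → i < r → 3 * q + i < n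
    remainder<n i i<r = subst (3 * q + i <_) (sym n-eq) (+-monoʳ-< (3 * q) i<r)

    remainder≢bench : ∀ j k i → j < q → k < 3 → i < r → 3 * q + i ≢ 3 * j + k
    remainder≢bench j k i j<q k<3 i<r = seat-≢-bench q i j k (<-trans i<r r<3) k<3 (λ e → <-irrefl (sym e) j<q)

    remainder≢leftmost : ∀ j i → j < q → i < r → 3 * q + i ≢ 3 * j
    remainder≢leftmost j i j<q i<r e = remainder≢bench j 0 i j<q (s≤s z≤n) i<r (trans e (3*j≡3*j+0 j))

    1<3 : 1 < 3
    1<3 = s≤s (s≤s z≤n)
    2<3 : 2 < 3
    2<3 = s≤s (s≤s (s≤s z≤n))
    0<1 : 0 < 1
    0<1 = s≤s z≤n
    0<2 : 0 < 2
    0<2 = s≤s z≤n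

    plusCount-plus : ∀ t → signOf σ t ≡ plus → plusCount σ (suc t) ≡ suc (plusCount σ t)
    plusCount-plus t e rewrite e = +-comm (plusCount σ t) 1
    minusCount-plus : ∀ t → signOf σ t ≡ plus → minusCount σ (suc t) ≡ minusCount σ t
    minusCount-plus t e rewrite e = +-identityʳ (minusCount σ t)
    plusCount-minus : ∀ t → signOf σ t ≡ minus → plusCount σ (suc t) ≡ plusCount σ t
    plusCount-minus t e rewrite e = +-identityʳ (plusCount σ t)
    minusCount-minus : ∀ t → signOf σ t ≡ minus → minusCount σ (suc t) ≡ suc (minusCount σ t)
    minusCount-minus t e rewrite e = +-comm (minusCount σ t) 1

    weaken-witness : ∀ {t} {P : ℕ → Set} {x : ℕ} → (x ≡ 0 ⊎ Σ ℕ (λ k → k ≤ t × P k)) → (x ≡ 0 ⊎ Σ ℕ (λ k → k ≤ suc t × P k))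
    weaken-witness (inj₁ e) = inj₁ e
    weaken-witness (inj₂ (k , le , p)) = inj₂ (k , m≤n⇒m≤1+n le , p)

    plus≢minus : plus ≡ minus → ⊥
    plus≢minus ()

    SignAt-subst : ∀ {s} {x y : Maybe ℕ} → y ≡ x → SignAt s x → SignAt s y
    SignAt-subst refl p = p

    centreLatest-keep : ∀ (A A' : Arrangement) j → A' (3 * j) ≡ A (3 * j) → A' (3 * j + 1) ≡ A (3 * j + 1) →
        A' (3 * j + 2) ≡ A (3 * j + 2) →
      (Σ ℕ λ a → Σ ℕ λ x → Σ ℕ λ b → A (3 * j) ≡ just a × A (3 * j + 1) ≡ just x × A (3 * j + 2) ≡ just b × a < x × b < x) →
      (Σ ℕ λ a → Σ ℕ λ x → Σ ℕ λ b → A' (3 * j) ≡ just a × A' (3 * j + 1) ≡ just x × A' (3 * j + 2) ≡ just b × a < x × b < x)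
    centreLatest-keep A A' j e0 e1 e2 (a , x , b , p0 , p1 , p2 , lt1 , lt2) = a , x , b , trans e0 p0 , trans e1 p1 , trans e2 p2 , lt1 , lt2

    SignAt-unique : ∀ {x} → SignAt plus x → SignAt minus x → ⊥
    SignAt-unique {just a} p m = plus≢minus (trans (sym p) m)

    overflow-rearrange : ∀ X q r k⁺ → X + (q + r) + 2 * suc k⁺ ≡ suc (q + k⁺ + (X + k⁺ + r)) + 1
    overflow-rearrange = solve-∀

    module Step (t : ℕ) (A : Arrangement) (G : Counters) (I : Invariant t A G) (t<n : t < n) where
      open Counters G
      open Invariant I

      module PlusLeft (sp : signOf σ t ≡ plus) (ℓ<q : ℓ < q) where
        S = 3 * ℓ
        A' = assign A (just S) t
        free : A S ≡ nothing
        free = unassigned⇒nothing A S (trans (leftmostFilled ℓ ℓ<q) (≤→<ᵇ {ℓ} {ℓ} ≤-refl))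
        S<n : S < n
        S<n = subst (_< n) (sym (3*j≡3*j+0 ℓ)) (seat<n ℓ 0 ℓ<q (s≤s z≤n))
        open SeatOfUpdate t A seatOf S free S<n seatOf-assigned seatOf-< assigned-seatOf using (seatOf-assigned′; seatOf-<′; assigned-seatOf′)
        sameC : ∀ j → A' (3 * j + 1) ≡ A (3 * j + 1)
        sameC j = assign-≢ A S t _ (offset≢leftmost j ℓ 1 0<1 1<3)
        sameR : ∀ j → A' (3 * j + 2) ≡ A (3 * j + 2)
        sameR j = assign-≢ A S t _ (offset≢leftmost j ℓ 2 0<2 2<3)
        sameL : ∀ j → j ≢ ℓ → A' (3 * j) ≡ A (3 * j)
        sameL j ne = assign-≢ A S t _ (leftmost-≢ j ℓ ne)

        ends : ΣN q (λ j → ι (endsDiffer A j)) + ι (endsDiffer A' ℓ) ≡ ΣN q (λ j → ι (endsDiffer A' j))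
        ends = ΣN-update q _ _ ℓ ℓ<q (cong ι (endsDiffer-noLeft A ℓ free)) (λ j _ ne → cong ι (sym (endsDiffer-cong A A' j (sameL j ne) (sameR j))))

        differingEnds′ : suc ℓ ⊓ ρ ≤ ΣN q (λ j → ι (endsDiffer A' j)) + k⁺ + k⁻
        differingEnds′ with ℓ <? ρ
        ... | yes lt = newlyDiffering lt (assigned⇒just A (3 * ℓ + 2) (trans (rightmostFilled ℓ ℓ<q) (<→<ᵇ lt)))
          where
          newlyDiffering : ℓ < ρ → Σ ℕ (λ b → A (3 * ℓ + 2) ≡ just b) → suc ℓ ⊓ ρ ≤ ΣN q (λ j → ι (endsDiffer A' j)) + k⁺ + k⁻
          newlyDiffering lt (b , Ab) = begin
                suc ℓ ⊓ ρ ≡⟨ m<n⇒[1+m]⊓n≡1+[m⊓n] ℓ ρ lt ⟩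
                suc (ℓ ⊓ ρ) ≤⟨ s≤s differingEnds ⟩
                suc (ΣN q (λ j → ι (endsDiffer A j)) + k⁺ + k⁻) ≡⟨ cong (λ z → z + k⁺ + k⁻) (trans (+-comm 1 _) (cong (ΣN q (λ j → ι (endsDiffer A j)) +_) (sym dif))) ⟩
                ΣN q (λ j → ι (endsDiffer A j)) + ι (endsDiffer A' ℓ) + k⁺ + k⁻ ≡⟨ cong (λ z → z + k⁺ + k⁻) ends ⟩
                ΣN q (λ j → ι (endsDiffer A' j)) + k⁺ + k⁻ ∎
            where
            open ≤-Reasoning
            sb : signOf σ b ≡ minus
            sb = subst (SignAt minus) Ab (rightmostMinus ℓ<q ℓ lt)
            dif : ι (endsDiffer A' ℓ) ≡ 1
            dif = cong ι (trans (endsDiffer-val A' ℓ t b (assign-≡ A S t) (trans (sameR ℓ) Ab)) (cong₂ differ sp sb))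
        ... | no nlt = begin
                suc ℓ ⊓ ρ ≡⟨ n≤m⇒[1+m]⊓n≡m⊓n ℓ ρ (≮⇒≥ nlt) ⟩
                ℓ ⊓ ρ ≤⟨ differingEnds ⟩
                ΣN q (λ j → ι (endsDiffer A j)) + k⁺ + k⁻ ≤⟨ +-monoˡ-≤ k⁻ (+-monoˡ-≤ k⁺ (≤-trans (m≤m+n _ _) (≤-reflexive ends))) ⟩
                ΣN q (λ j → ι (endsDiffer A' j)) + k⁺ + k⁻ ∎
          where open ≤-Reasoning

        counters′ : Counters
        counters′ = counters (suc ℓ) ρ c e k⁺ k⁻ c⁺ c⁻ (seatOf-update seatOf t S)

        invariant′ : Invariant (suc t) A' counters′
        invariant′ = record
          { t≤n = t<n ; ℓ≤q = ℓ<q ; ρ≤q = ρ≤q ; c≤ℓ = m≤n⇒m≤1+n c≤ℓ ; c≤ρ = c≤ρ ; e≤r = e≤r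
          ; leftmostFilled = λ j j<q → assigned-bump A t (3 *_) 3*-injective j ℓ (leftmostFilled j j<q)
          ; centreFilled = λ j j<q → trans (assigned-assign-≢ A S t _ (offset≢leftmost j ℓ 1 0<1 1<3)) (centreFilled j j<q)
          ; rightmostFilled = λ j j<q → trans (assigned-assign-≢ A S t _ (offset≢leftmost j ℓ 2 0<2 2<3)) (rightmostFilled j j<q)
          ; remainderFilled = λ i i<r → trans (assigned-assign-≢ A S t _ (remainder≢leftmost ℓ i ℓ<q i<r)) (remainderFilled i i<r)
          ; t≡ℓ+ρ+c+e = cong suc t≡ℓ+ρ+c+e
          ; plusTally = trans (cong (_+ k⁻) (plusCount-plus t sp)) (cong suc plusTally)
          ; minusTally = trans (cong (_+ k⁺) (minusCount-plus t sp)) minusTally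
          ; centreTally = centreTally
          ; ℓ<q⇒k⁺≡c⁺≡0 = λ lt → ℓ<q⇒k⁺≡c⁺≡0 (<-trans (n<1+n ℓ) lt)
          ; ρ<q⇒k⁻≡c⁻≡0 = ρ<q⇒k⁻≡c⁻≡0 ; k⁺≡0⊎k⁻≡0 = k⁺≡0⊎k⁻≡0 ; k⁺-drift = weaken-witness k⁺-drift ; k⁻-drift = weaken-witness k⁻-drift
          ; rightmostMinus = λ lt j j<ρ → SignAt-subst (sameR j) (rightmostMinus (<-trans (n<1+n ℓ) lt) j j<ρ)
          ; leftmostPlus = λ lt j j<sℓ → leftmostPlus′ lt j j<sℓ
          ; noMinusPlusBench = noMinusPlusBench′
          ; differingEnds = differingEnds′
          ; centreLatest = λ j j<c → centreLatest-keep A A' j (sameL j (λ e → <-irrefl e (<-≤-trans j<c c≤ℓ))) (sameC j) (sameR j) (centreLatest j j<c)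
          ; seatOf-assigned = seatOf-assigned′ ; seatOf-< = seatOf-<′ ; assigned-seatOf = assigned-seatOf′ }
          where
          leftmostPlus′ : ρ < q → ∀ j → j < suc ℓ → SignAt plus (A' (3 * j))
          leftmostPlus′ lt j j<sℓ with j ≟ ℓ
          ... | yes refl = SignAt-subst (assign-≡ A S t) sp
          ... | no ne = SignAt-subst (sameL j ne) (leftmostPlus lt j (≤∧≢⇒< (≤-pred j<sℓ) ne))
          noMinusPlusBench′ : ∀ j → j < suc ℓ → j < ρ → SignAt minus (A' (3 * j)) → SignAt plus (A' (3 * j + 2)) → ⊥
          noMinusPlusBench′ j j<sℓ j<ρ m p with j ≟ ℓ
          ... | yes refl = plus≢minus (trans (sym sp) (SignAt-subst (sym (assign-≡ A S t)) m))
          ... | no ne = noMinusPlusBench j (≤∧≢⇒< (≤-pred j<sℓ) ne) j<ρ (SignAt-subst (sym (sameL j ne)) m) (SignAt-subst (sym (sameR j)) p)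

      endsDiffer-ΣN-same : ∀ (A' : Arrangement) → (∀ j → A' (3 * j) ≡ A (3 * j)) → (∀ j → A' (3 * j + 2) ≡ A (3 * j + 2)) →
                  ΣN q (λ j → ι (endsDiffer A' j)) ≡ ΣN q (λ j → ι (endsDiffer A j))
      endsDiffer-ΣN-same A' e0 e2 = ΣN-cong q (λ j _ → cong ι (endsDiffer-cong A A' j (e0 j) (e2 j)))

      module PlusCentre (sp : signOf σ t ≡ plus) (ℓ=q : ℓ ≡ q) (c<ρ : c < ρ) where
        c<q = <-≤-trans c<ρ ρ≤q
        S = 3 * c + 1
        A' = assign A (just S) t
        free : A S ≡ nothing
        free = unassigned⇒nothing A S (trans (centreFilled c c<q) (≤→<ᵇ {c} {c} ≤-refl))
        S<n : S < n
        S<n = seat<n c 1 c<q 1<3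
        open SeatOfUpdate t A seatOf S free S<n seatOf-assigned seatOf-< assigned-seatOf using (seatOf-assigned′; seatOf-<′; assigned-seatOf′)
        sameL : ∀ j → A' (3 * j) ≡ A (3 * j)
        sameL j = assign-≢ A S t _ (leftmost≢offset j c 1 0<1 1<3)
        sameR : ∀ j → A' (3 * j + 2) ≡ A (3 * j + 2)
        sameR j = assign-≢ A S t _ (seat-≢-offset j 2 c 1 2<3 1<3 (λ ()))
        sameC : ∀ j → j ≢ c → A' (3 * j + 1) ≡ A (3 * j + 1)
        sameC j ne = assign-≢ A S t _ (seat-≢-bench j 1 c 1 1<3 1<3 ne)

        counters′ : Counters
        counters′ = counters ℓ ρ (suc c) e k⁺ k⁻ (suc c⁺) c⁻ (seatOf-update seatOf t S)

        invariant′ : Invariant (suc t) A' counters′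
        invariant′ = record
          { t≤n = t<n ; ℓ≤q = ℓ≤q ; ρ≤q = ρ≤q ; c≤ℓ = subst (suc c ≤_) (sym ℓ=q) c<q ; c≤ρ = c<ρ ; e≤r = e≤r
          ; leftmostFilled = λ j j<q → trans (assigned-assign-≢ A S t _ (leftmost≢offset j c 1 0<1 1<3)) (leftmostFilled j j<q)
          ; centreFilled = λ j j<q → assigned-bump A t (λ j → 3 * j + 1) (3*+k-injective 1 1<3) j c (centreFilled j j<q)
          ; rightmostFilled = λ j j<q → trans (assigned-assign-≢ A S t _ (seat-≢-offset j 2 c 1 2<3 1<3 (λ ()))) (rightmostFilled j j<q)
          ; remainderFilled = λ i i<r → trans (assigned-assign-≢ A S t _ (remainder≢bench c 1 i c<q 1<3 i<r)) (remainderFilled i i<r)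
          ; t≡ℓ+ρ+c+e = trans (cong suc t≡ℓ+ρ+c+e) (sym (cong (_+ e) (+-suc (ℓ + ρ) c)))
          ; plusTally = trans (cong (_+ k⁻) (plusCount-plus t sp)) (trans (cong suc plusTally) (sym (+-suc (ℓ + k⁺) c⁺)))
          ; minusTally = trans (cong (_+ k⁺) (minusCount-plus t sp)) minusTally
          ; centreTally = cong suc centreTally
          ; ℓ<q⇒k⁺≡c⁺≡0 = λ lt → ⊥-elim (<-irrefl ℓ=q lt)
          ; ρ<q⇒k⁻≡c⁻≡0 = ρ<q⇒k⁻≡c⁻≡0 ; k⁺≡0⊎k⁻≡0 = k⁺≡0⊎k⁻≡0 ; k⁺-drift = weaken-witness k⁺-drift ; k⁻-drift = weaken-witness k⁻-drift
          ; rightmostMinus = λ lt → ⊥-elim (<-irrefl ℓ=q lt)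
          ; leftmostPlus = λ lt j j<ℓ → SignAt-subst (sameL j) (leftmostPlus lt j j<ℓ)
          ; noMinusPlusBench = λ j j<ℓ j<ρ m p → noMinusPlusBench j j<ℓ j<ρ (SignAt-subst (sym (sameL j)) m) (SignAt-subst (sym (sameR j)) p)
          ; differingEnds = subst (λ z → ℓ ⊓ ρ ≤ z + k⁺ + k⁻) (sym (endsDiffer-ΣN-same A' sameL sameR)) differingEnds
          ; centreLatest = centreLatest′
          ; seatOf-assigned = seatOf-assigned′ ; seatOf-< = seatOf-<′ ; assigned-seatOf = assigned-seatOf′ }
          where
          centreLatest′ : ∀ j → j < suc c → Σ ℕ λ a → Σ ℕ λ x → Σ ℕ λ b →
                A' (3 * j) ≡ just a × A' (3 * j + 1) ≡ just x × A' (3 * j + 2) ≡ just b × a < x × b < x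
          centreLatest′ j j<sc with j ≟ c
          ... | no ne = centreLatest-keep A A' j (sameL j) (sameC j ne) (sameR j) (centreLatest j (≤∧≢⇒< (≤-pred j<sc) ne))
          ... | yes refl with assigned⇒just A (3 * j) (trans (leftmostFilled j c<q) (<→<ᵇ (subst (j <_) (sym ℓ=q) c<q))) | assigned⇒just A (3 * j + 2) (trans (rightmostFilled j c<q) (<→<ᵇ c<ρ))
          ...   | (a , Aa) | (b , Ab) = a , t , b , trans (sameL j) Aa , assign-≡ A S t , trans (sameR j) Ab ,
                                         proj₁ (assigned-seatOf _ a Aa) , proj₁ (assigned-seatOf _ b Ab)

      module PlusRemainder (sp : signOf σ t ≡ plus) (ℓ=q : ℓ ≡ q) (c=ρ : c ≡ ρ) (e<r : e < r) where
        S = 3 * q + e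
        A' = assign A (just S) t
        free : A S ≡ nothing
        free = unassigned⇒nothing A S (trans (remainderFilled e e<r) (≤→<ᵇ {e} {e} ≤-refl))
        S<n : S < n
        S<n = remainder<n e e<r
        open SeatOfUpdate t A seatOf S free S<n seatOf-assigned seatOf-< assigned-seatOf using (seatOf-assigned′; seatOf-<′; assigned-seatOf′)
        sameB : ∀ j k → j < q → k < 3 → A' (3 * j + k) ≡ A (3 * j + k)
        sameB j k j<q k<3 = assign-≢ A S t _ (λ e' → remainder≢bench j k e j<q k<3 e<r (sym e'))

        counters′ : Counters
        counters′ = counters ℓ ρ c (suc e) k⁺ k⁻ (suc c⁺) c⁻ (seatOf-update seatOf t S)

        sameL : ∀ j → j < q → A' (3 * j) ≡ A (3 * j)
        sameL j j<q = assign-≢ A S t _ (λ e' → remainder≢leftmost j e j<q e<r (sym e'))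
        sameR : ∀ j → j < q → A' (3 * j + 2) ≡ A (3 * j + 2)
        sameR j j<q = sameB j 2 j<q 2<3

        invariant′ : Invariant (suc t) A' counters′
        invariant′ = record
          { t≤n = t<n ; ℓ≤q = ℓ≤q ; ρ≤q = ρ≤q ; c≤ℓ = c≤ℓ ; c≤ρ = c≤ρ ; e≤r = e<r
          ; leftmostFilled = λ j j<q → trans (assigned-assign-≢ A S t _ (λ e' → remainder≢leftmost j e j<q e<r (sym e'))) (leftmostFilled j j<q)
          ; centreFilled = λ j j<q → trans (assigned-assign-≢ A S t _ (λ e' → remainder≢bench j 1 e j<q 1<3 e<r (sym e'))) (centreFilled j j<q)
          ; rightmostFilled = λ j j<q → trans (assigned-assign-≢ A S t _ (λ e' → remainder≢bench j 2 e j<q 2<3 e<r (sym e'))) (rightmostFilled j j<q)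
          ; remainderFilled = λ i i<r → assigned-bump A t (3 * q +_) (λ a b → +-cancelˡ-≡ (3 * q) a b) i e (remainderFilled i i<r)
          ; t≡ℓ+ρ+c+e = trans (cong suc t≡ℓ+ρ+c+e) (sym (+-suc (ℓ + ρ + c) e))
          ; plusTally = trans (cong (_+ k⁻) (plusCount-plus t sp)) (trans (cong suc plusTally) (sym (+-suc (ℓ + k⁺) c⁺)))
          ; minusTally = trans (cong (_+ k⁺) (minusCount-plus t sp)) minusTally
          ; centreTally = trans (+-suc c e) (cong suc centreTally)
          ; ℓ<q⇒k⁺≡c⁺≡0 = λ lt → ⊥-elim (<-irrefl ℓ=q lt)
          ; ρ<q⇒k⁻≡c⁻≡0 = ρ<q⇒k⁻≡c⁻≡0 ; k⁺≡0⊎k⁻≡0 = k⁺≡0⊎k⁻≡0 ; k⁺-drift = weaken-witness k⁺-drift ; k⁻-drift = weaken-witness k⁻-drift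
          ; rightmostMinus = λ lt → ⊥-elim (<-irrefl ℓ=q lt)
          ; leftmostPlus = λ lt j j<ℓ → SignAt-subst (sameL j (<-≤-trans j<ℓ ℓ≤q)) (leftmostPlus lt j j<ℓ)
          ; noMinusPlusBench = λ j j<ℓ j<ρ m p → noMinusPlusBench j j<ℓ j<ρ (SignAt-subst (sym (sameL j (<-≤-trans j<ℓ ℓ≤q))) m) (SignAt-subst (sym (sameR j (<-≤-trans j<ℓ ℓ≤q))) p)
          ; differingEnds = subst (λ z → ℓ ⊓ ρ ≤ z + k⁺ + k⁻) (sym (ΣN-cong q (λ j j<q → cong ι (endsDiffer-cong A A' j (sameL j j<q) (sameR j j<q))))) differingEnds
          ; centreLatest = λ j j<c → let j<q = <-≤-trans (<-≤-trans j<c c≤ℓ) ℓ≤q in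
                   centreLatest-keep A A' j (sameL j j<q) (sameB j 1 j<q 1<3) (sameR j j<q) (centreLatest j j<c)
          ; seatOf-assigned = seatOf-assigned′ ; seatOf-< = seatOf-<′ ; assigned-seatOf = assigned-seatOf′ }

      module PlusRight (sp : signOf σ t ≡ plus) (ℓ=q : ℓ ≡ q) (c=ρ : c ≡ ρ) (e=r : e ≡ r) (ρ<q : ρ < q) where
        S = 3 * ρ + 2
        A' = assign A (just S) t
        free : A S ≡ nothing
        free = unassigned⇒nothing A S (trans (rightmostFilled ρ ρ<q) (≤→<ᵇ {ρ} {ρ} ≤-refl))
        S<n : S < n
        S<n = seat<n ρ 2 ρ<q 2<3
        open SeatOfUpdate t A seatOf S free S<n seatOf-assigned seatOf-< assigned-seatOf using (seatOf-assigned′; seatOf-<′; assigned-seatOf′)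
        sameL : ∀ j → A' (3 * j) ≡ A (3 * j)
        sameL j = assign-≢ A S t _ (leftmost≢offset j ρ 2 0<2 2<3)
        sameC : ∀ j → A' (3 * j + 1) ≡ A (3 * j + 1)
        sameC j = assign-≢ A S t _ (seat-≢-offset j 1 ρ 2 1<3 2<3 (λ ()))
        sameR : ∀ j → j ≢ ρ → A' (3 * j + 2) ≡ A (3 * j + 2)
        sameR j ne = assign-≢ A S t _ (seat-≢-bench j 2 ρ 2 2<3 2<3 ne)

        k⁻≡0 = proj₁ (ρ<q⇒k⁻≡c⁻≡0 ρ<q)
        c⁻≡0 = proj₂ (ρ<q⇒k⁻≡c⁻≡0 ρ<q)

        counters′ : Counters
        counters′ = counters ℓ (suc ρ) c e (suc k⁺) k⁻ c⁺ c⁻ (seatOf-update seatOf t S)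

        ends : ΣN q (λ j → ι (endsDiffer A j)) + ι (endsDiffer A' ρ) ≡ ΣN q (λ j → ι (endsDiffer A' j))
        ends = ΣN-update q _ _ ρ ρ<q (cong ι (endsDiffer-noRight A ρ free)) (λ j _ ne → cong ι (sym (endsDiffer-cong A A' j (sameL j) (sameR j ne))))

        k⁺-drift′ : minusCount σ (suc t) + (q + r) + 2 * suc k⁺ ≤ plusCount σ (suc t) + 1
        k⁺-drift′ = ≤-reflexive (begin
            minusCount σ (suc t) + (q + r) + 2 * suc k⁺ ≡⟨ cong (λ z → z + (q + r) + 2 * suc k⁺) (minusCount-plus t sp) ⟩
            minusCount σ t + (q + r) + 2 * suc k⁺ ≡⟨ overflow-rearrange (minusCount σ t) q r k⁺ ⟩
            suc (q + k⁺ + (minusCount σ t + k⁺ + r)) + 1 ≡⟨ cong (λ z → suc (q + k⁺ + (z + r)) + 1) minusTally′ ⟩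
            suc (q + k⁺ + (ρ + r)) + 1 ≡⟨ cong (λ z → suc (q + k⁺ + z) + 1) ρ+r≡c⁺ ⟩
            suc (q + k⁺ + c⁺) + 1 ≡⟨ cong (λ z → suc (z + k⁺ + c⁺) + 1) (sym ℓ=q) ⟩
            suc (ℓ + k⁺ + c⁺) + 1 ≡⟨ cong (λ z → suc z + 1) (sym plusTally′) ⟩
            suc (plusCount σ t) + 1 ≡⟨ cong (_+ 1) (sym (plusCount-plus t sp)) ⟩
            plusCount σ (suc t) + 1 ∎)
          where
          open ≡-Reasoning
          minusTally′ : minusCount σ t + k⁺ ≡ ρ
          minusTally′ = trans minusTally (trans (cong₂ (λ a b → ρ + a + b) k⁻≡0 c⁻≡0) (trans (+-identityʳ (ρ + 0)) (+-identityʳ ρ)))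
          plusTally′ : plusCount σ t ≡ ℓ + k⁺ + c⁺
          plusTally′ = trans (sym (+-identityʳ (plusCount σ t))) (trans (cong (plusCount σ t +_) (sym k⁻≡0)) plusTally)
          ρ+r≡c⁺ : ρ + r ≡ c⁺
          ρ+r≡c⁺ = trans (cong₂ _+_ (sym c=ρ) (sym e=r)) (trans centreTally (trans (cong (c⁺ +_) c⁻≡0) (+-identityʳ c⁺)))

        invariant′ : Invariant (suc t) A' counters′
        invariant′ = record
          { t≤n = t<n ; ℓ≤q = ℓ≤q ; ρ≤q = ρ<q ; c≤ℓ = c≤ℓ ; c≤ρ = m≤n⇒m≤1+n c≤ρ ; e≤r = e≤r
          ; leftmostFilled = λ j j<q → trans (assigned-assign-≢ A S t _ (leftmost≢offset j ρ 2 0<2 2<3)) (leftmostFilled j j<q)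
          ; centreFilled = λ j j<q → trans (assigned-assign-≢ A S t _ (seat-≢-offset j 1 ρ 2 1<3 2<3 (λ ()))) (centreFilled j j<q)
          ; rightmostFilled = λ j j<q → assigned-bump A t (λ j → 3 * j + 2) (3*+k-injective 2 2<3) j ρ (rightmostFilled j j<q)
          ; remainderFilled = λ i i<r → trans (assigned-assign-≢ A S t _ (remainder≢bench ρ 2 i ρ<q 2<3 i<r)) (remainderFilled i i<r)
          ; t≡ℓ+ρ+c+e = trans (cong suc t≡ℓ+ρ+c+e) (sym (cong (λ x → x + c + e) (+-suc ℓ ρ)))
          ; plusTally = trans (cong (_+ k⁻) (plusCount-plus t sp)) (trans (cong suc plusTally) (sym (cong (_+ c⁺) (+-suc ℓ k⁺))))
          ; minusTally = trans (cong (_+ suc k⁺) (minusCount-plus t sp)) (trans (+-suc (minusCount σ t) k⁺) (cong suc minusTally))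
          ; centreTally = centreTally
          ; ℓ<q⇒k⁺≡c⁺≡0 = λ lt → ⊥-elim (<-irrefl ℓ=q lt)
          ; ρ<q⇒k⁻≡c⁻≡0 = λ lt → ρ<q⇒k⁻≡c⁻≡0 (<-trans (n<1+n ρ) lt)
          ; k⁺≡0⊎k⁻≡0 = inj₂ k⁻≡0 ; k⁺-drift = inj₂ (suc t , ≤-refl , k⁺-drift′) ; k⁻-drift = weaken-witness k⁻-drift
          ; rightmostMinus = λ lt → ⊥-elim (<-irrefl ℓ=q lt)
          ; leftmostPlus = λ lt j j<ℓ → SignAt-subst (sameL j) (leftmostPlus (<-trans (n<1+n ρ) lt) j j<ℓ)
          ; noMinusPlusBench = noMinusPlusBench′
          ; differingEnds = differingEnds′
          ; centreLatest = λ j j<c → centreLatest-keep A A' j (sameL j) (sameC j) (sameR j (λ e' → <-irrefl (trans e' (sym c=ρ)) j<c)) (centreLatest j j<c)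
          ; seatOf-assigned = seatOf-assigned′ ; seatOf-< = seatOf-<′ ; assigned-seatOf = assigned-seatOf′ }
          where
          noMinusPlusBench′ : ∀ j → j < ℓ → j < suc ρ → SignAt minus (A' (3 * j)) → SignAt plus (A' (3 * j + 2)) → ⊥
          noMinusPlusBench′ j j<ℓ j<sρ m p with j ≟ ρ
          ... | yes refl = SignAt-unique (leftmostPlus ρ<q j j<ℓ) (SignAt-subst (sym (sameL j)) m)
          ... | no ne = noMinusPlusBench j j<ℓ (≤∧≢⇒< (≤-pred j<sρ) ne) (SignAt-subst (sym (sameL j)) m) (SignAt-subst (sym (sameR j ne)) p)
          differingEnds′ : ℓ ⊓ suc ρ ≤ ΣN q (λ j → ι (endsDiffer A' j)) + suc k⁺ + k⁻
          differingEnds′ = begin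
            ℓ ⊓ suc ρ ≤⟨ m⊓[1+n]≤1+[m⊓n] ℓ ρ ⟩
            suc (ℓ ⊓ ρ) ≤⟨ s≤s differingEnds ⟩
            suc (ΣN q (λ j → ι (endsDiffer A j)) + k⁺ + k⁻) ≤⟨ s≤s (+-monoˡ-≤ k⁻ (+-monoˡ-≤ k⁺ (≤-trans (m≤m+n _ _) (≤-reflexive ends)))) ⟩
            suc (ΣN q (λ j → ι (endsDiffer A' j)) + k⁺ + k⁻) ≡⟨ cong (_+ k⁻) (sym (+-suc _ k⁺)) ⟩
            ΣN q (λ j → ι (endsDiffer A' j)) + suc k⁺ + k⁻ ∎
            where open ≤-Reasoning

      module MinusRight (sm : signOf σ t ≡ minus) (ρ<q : ρ < q) where
        S = 3 * ρ + 2
        A' = assign A (just S) t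
        free : A S ≡ nothing
        free = unassigned⇒nothing A S (trans (rightmostFilled ρ ρ<q) (≤→<ᵇ {ρ} {ρ} ≤-refl))
        S<n : S < n
        S<n = seat<n ρ 2 ρ<q 2<3
        open SeatOfUpdate t A seatOf S free S<n seatOf-assigned seatOf-< assigned-seatOf using (seatOf-assigned′; seatOf-<′; assigned-seatOf′)
        sameL : ∀ j → A' (3 * j) ≡ A (3 * j)
        sameL j = assign-≢ A S t _ (leftmost≢offset j ρ 2 0<2 2<3)
        sameC : ∀ j → A' (3 * j + 1) ≡ A (3 * j + 1)
        sameC j = assign-≢ A S t _ (seat-≢-offset j 1 ρ 2 1<3 2<3 (λ ()))
        sameR : ∀ j → j ≢ ρ → A' (3 * j + 2) ≡ A (3 * j + 2)
        sameR j ne = assign-≢ A S t _ (seat-≢-bench j 2 ρ 2 2<3 2<3 ne)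

        ends : ΣN q (λ j → ι (endsDiffer A j)) + ι (endsDiffer A' ρ) ≡ ΣN q (λ j → ι (endsDiffer A' j))
        ends = ΣN-update q _ _ ρ ρ<q (cong ι (endsDiffer-noRight A ρ free)) (λ j _ ne → cong ι (sym (endsDiffer-cong A A' j (sameL j) (sameR j ne))))

        differingEnds′ : ℓ ⊓ suc ρ ≤ ΣN q (λ j → ι (endsDiffer A' j)) + k⁺ + k⁻
        differingEnds′ with ρ <? ℓ
        ... | yes lt = newlyDiffering lt (assigned⇒just A (3 * ρ) (trans (leftmostFilled ρ ρ<q) (<→<ᵇ lt)))
          where
          newlyDiffering : ρ < ℓ → Σ ℕ (λ a → A (3 * ρ) ≡ just a) → ℓ ⊓ suc ρ ≤ ΣN q (λ j → ι (endsDiffer A' j)) + k⁺ + k⁻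
          newlyDiffering lt (a , Aa) = begin
                ℓ ⊓ suc ρ ≡⟨ n<m⇒m⊓[1+n]≡1+[m⊓n] ℓ ρ lt ⟩
                suc (ℓ ⊓ ρ) ≤⟨ s≤s differingEnds ⟩
                suc (ΣN q (λ j → ι (endsDiffer A j)) + k⁺ + k⁻) ≡⟨ cong (λ z → z + k⁺ + k⁻) (trans (+-comm 1 _) (cong (ΣN q (λ j → ι (endsDiffer A j)) +_) (sym dif))) ⟩
                ΣN q (λ j → ι (endsDiffer A j)) + ι (endsDiffer A' ρ) + k⁺ + k⁻ ≡⟨ cong (λ z → z + k⁺ + k⁻) ends ⟩
                ΣN q (λ j → ι (endsDiffer A' j)) + k⁺ + k⁻ ∎
            where
            open ≤-Reasoning
            sa : signOf σ a ≡ plus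
            sa = subst (SignAt plus) Aa (leftmostPlus ρ<q ρ lt)
            dif : ι (endsDiffer A' ρ) ≡ 1
            dif = cong ι (trans (endsDiffer-val A' ρ a t (trans (sameL ρ) Aa) (assign-≡ A S t)) (cong₂ differ sa sm))
        ... | no nlt = begin
                ℓ ⊓ suc ρ ≡⟨ m≤n⇒m⊓[1+n]≡m⊓n ℓ ρ (≮⇒≥ nlt) ⟩
                ℓ ⊓ ρ ≤⟨ differingEnds ⟩
                ΣN q (λ j → ι (endsDiffer A j)) + k⁺ + k⁻ ≤⟨ +-monoˡ-≤ k⁻ (+-monoˡ-≤ k⁺ (≤-trans (m≤m+n _ _) (≤-reflexive ends))) ⟩
                ΣN q (λ j → ι (endsDiffer A' j)) + k⁺ + k⁻ ∎
          where open ≤-Reasoning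

        counters′ : Counters
        counters′ = counters ℓ (suc ρ) c e k⁺ k⁻ c⁺ c⁻ (seatOf-update seatOf t S)

        invariant′ : Invariant (suc t) A' counters′
        invariant′ = record
          { t≤n = t<n ; ℓ≤q = ℓ≤q ; ρ≤q = ρ<q ; c≤ℓ = c≤ℓ ; c≤ρ = m≤n⇒m≤1+n c≤ρ ; e≤r = e≤r
          ; leftmostFilled = λ j j<q → trans (assigned-assign-≢ A S t _ (leftmost≢offset j ρ 2 0<2 2<3)) (leftmostFilled j j<q)
          ; centreFilled = λ j j<q → trans (assigned-assign-≢ A S t _ (seat-≢-offset j 1 ρ 2 1<3 2<3 (λ ()))) (centreFilled j j<q)
          ; rightmostFilled = λ j j<q → assigned-bump A t (λ j → 3 * j + 2) (3*+k-injective 2 2<3) j ρ (rightmostFilled j j<q)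
          ; remainderFilled = λ i i<r → trans (assigned-assign-≢ A S t _ (remainder≢bench ρ 2 i ρ<q 2<3 i<r)) (remainderFilled i i<r)
          ; t≡ℓ+ρ+c+e = trans (cong suc t≡ℓ+ρ+c+e) (sym (cong (λ x → x + c + e) (+-suc ℓ ρ)))
          ; plusTally = trans (cong (_+ k⁻) (plusCount-minus t sm)) plusTally
          ; minusTally = trans (cong (_+ k⁺) (minusCount-minus t sm)) (cong suc minusTally)
          ; centreTally = centreTally
          ; ℓ<q⇒k⁺≡c⁺≡0 = ℓ<q⇒k⁺≡c⁺≡0
          ; ρ<q⇒k⁻≡c⁻≡0 = λ lt → ρ<q⇒k⁻≡c⁻≡0 (<-trans (n<1+n ρ) lt)
          ; k⁺≡0⊎k⁻≡0 = k⁺≡0⊎k⁻≡0 ; k⁺-drift = weaken-witness k⁺-drift ; k⁻-drift = weaken-witness k⁻-drift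
          ; rightmostMinus = rightmostMinus′
          ; leftmostPlus = λ lt j j<ℓ → SignAt-subst (sameL j) (leftmostPlus (<-trans (n<1+n ρ) lt) j j<ℓ)
          ; noMinusPlusBench = noMinusPlusBench′
          ; differingEnds = differingEnds′
          ; centreLatest = λ j j<c → centreLatest-keep A A' j (sameL j) (sameC j) (sameR j (λ e' → <-irrefl e' (<-≤-trans j<c c≤ρ))) (centreLatest j j<c)
          ; seatOf-assigned = seatOf-assigned′ ; seatOf-< = seatOf-<′ ; assigned-seatOf = assigned-seatOf′ }
          where
          rightmostMinus′ : ℓ < q → ∀ j → j < suc ρ → SignAt minus (A' (3 * j + 2))
          rightmostMinus′ lt j j<sρ with j ≟ ρ
          ... | yes refl = SignAt-subst (assign-≡ A S t) sm
          ... | no ne = SignAt-subst (sameR j ne) (rightmostMinus lt j (≤∧≢⇒< (≤-pred j<sρ) ne))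
          noMinusPlusBench′ : ∀ j → j < ℓ → j < suc ρ → SignAt minus (A' (3 * j)) → SignAt plus (A' (3 * j + 2)) → ⊥
          noMinusPlusBench′ j j<ℓ j<sρ m p with j ≟ ρ
          ... | yes refl = plus≢minus (trans (sym (SignAt-subst (sym (assign-≡ A S t)) p)) sm)
          ... | no ne = noMinusPlusBench j j<ℓ (≤∧≢⇒< (≤-pred j<sρ) ne) (SignAt-subst (sym (sameL j)) m) (SignAt-subst (sym (sameR j ne)) p)

      module MinusCentre (sm : signOf σ t ≡ minus) (ρ=q : ρ ≡ q) (c<ℓ : c < ℓ) where
        c<q = <-≤-trans c<ℓ ℓ≤q
        S = 3 * c + 1
        A' = assign A (just S) t
        free : A S ≡ nothing
        free = unassigned⇒nothing A S (trans (centreFilled c c<q) (≤→<ᵇ {c} {c} ≤-refl))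
        S<n : S < n
        S<n = seat<n c 1 c<q 1<3
        open SeatOfUpdate t A seatOf S free S<n seatOf-assigned seatOf-< assigned-seatOf using (seatOf-assigned′; seatOf-<′; assigned-seatOf′)
        sameL : ∀ j → A' (3 * j) ≡ A (3 * j)
        sameL j = assign-≢ A S t _ (leftmost≢offset j c 1 0<1 1<3)
        sameR : ∀ j → A' (3 * j + 2) ≡ A (3 * j + 2)
        sameR j = assign-≢ A S t _ (seat-≢-offset j 2 c 1 2<3 1<3 (λ ()))
        sameC : ∀ j → j ≢ c → A' (3 * j + 1) ≡ A (3 * j + 1)
        sameC j ne = assign-≢ A S t _ (seat-≢-bench j 1 c 1 1<3 1<3 ne)

        counters′ : Counters
        counters′ = counters ℓ ρ (suc c) e k⁺ k⁻ c⁺ (suc c⁻) (seatOf-update seatOf t S)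

        invariant′ : Invariant (suc t) A' counters′
        invariant′ = record
          { t≤n = t<n ; ℓ≤q = ℓ≤q ; ρ≤q = ρ≤q ; c≤ℓ = c<ℓ ; c≤ρ = subst (suc c ≤_) (sym ρ=q) c<q ; e≤r = e≤r
          ; leftmostFilled = λ j j<q → trans (assigned-assign-≢ A S t _ (leftmost≢offset j c 1 0<1 1<3)) (leftmostFilled j j<q)
          ; centreFilled = λ j j<q → assigned-bump A t (λ j → 3 * j + 1) (3*+k-injective 1 1<3) j c (centreFilled j j<q)
          ; rightmostFilled = λ j j<q → trans (assigned-assign-≢ A S t _ (seat-≢-offset j 2 c 1 2<3 1<3 (λ ()))) (rightmostFilled j j<q)
          ; remainderFilled = λ i i<r → trans (assigned-assign-≢ A S t _ (remainder≢bench c 1 i c<q 1<3 i<r)) (remainderFilled i i<r)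
          ; t≡ℓ+ρ+c+e = trans (cong suc t≡ℓ+ρ+c+e) (sym (cong (_+ e) (+-suc (ℓ + ρ) c)))
          ; plusTally = trans (cong (_+ k⁻) (plusCount-minus t sm)) plusTally
          ; minusTally = trans (cong (_+ k⁺) (minusCount-minus t sm)) (trans (cong suc minusTally) (sym (+-suc (ρ + k⁻) c⁻)))
          ; centreTally = trans (cong suc centreTally) (sym (+-suc c⁺ c⁻))
          ; ℓ<q⇒k⁺≡c⁺≡0 = ℓ<q⇒k⁺≡c⁺≡0
          ; ρ<q⇒k⁻≡c⁻≡0 = λ lt → ⊥-elim (<-irrefl ρ=q lt)
          ; k⁺≡0⊎k⁻≡0 = k⁺≡0⊎k⁻≡0 ; k⁺-drift = weaken-witness k⁺-drift ; k⁻-drift = weaken-witness k⁻-drift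
          ; rightmostMinus = λ lt j j<ρ → SignAt-subst (sameR j) (rightmostMinus lt j j<ρ)
          ; leftmostPlus = λ lt → ⊥-elim (<-irrefl ρ=q lt)
          ; noMinusPlusBench = λ j j<ℓ j<ρ m p → noMinusPlusBench j j<ℓ j<ρ (SignAt-subst (sym (sameL j)) m) (SignAt-subst (sym (sameR j)) p)
          ; differingEnds = subst (λ z → ℓ ⊓ ρ ≤ z + k⁺ + k⁻) (sym (endsDiffer-ΣN-same A' sameL sameR)) differingEnds
          ; centreLatest = centreLatest′
          ; seatOf-assigned = seatOf-assigned′ ; seatOf-< = seatOf-<′ ; assigned-seatOf = assigned-seatOf′ }
          where
          centreLatest′ : ∀ j → j < suc c → Σ ℕ λ a → Σ ℕ λ x → Σ ℕ λ b →
                A' (3 * j) ≡ just a × A' (3 * j + 1) ≡ just x × A' (3 * j + 2) ≡ just b × a < x × b < x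
          centreLatest′ j j<sc with j ≟ c
          ... | no ne = centreLatest-keep A A' j (sameL j) (sameC j ne) (sameR j) (centreLatest j (≤∧≢⇒< (≤-pred j<sc) ne))
          ... | yes refl with assigned⇒just A (3 * j) (trans (leftmostFilled j c<q) (<→<ᵇ c<ℓ)) | assigned⇒just A (3 * j + 2) (trans (rightmostFilled j c<q) (<→<ᵇ (subst (j <_) (sym ρ=q) c<q)))
          ...   | (a , Aa) | (b , Ab) = a , t , b , trans (sameL j) Aa , assign-≡ A S t , trans (sameR j) Ab ,
                                         proj₁ (assigned-seatOf _ a Aa) , proj₁ (assigned-seatOf _ b Ab)

      module MinusRemainder (sm : signOf σ t ≡ minus) (ρ=q : ρ ≡ q) (c=ℓ : c ≡ ℓ) (e<r : e < r) where
        S = 3 * q + e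
        A' = assign A (just S) t
        free : A S ≡ nothing
        free = unassigned⇒nothing A S (trans (remainderFilled e e<r) (≤→<ᵇ {e} {e} ≤-refl))
        S<n : S < n
        S<n = remainder<n e e<r
        open SeatOfUpdate t A seatOf S free S<n seatOf-assigned seatOf-< assigned-seatOf using (seatOf-assigned′; seatOf-<′; assigned-seatOf′)
        sameB : ∀ j k → j < q → k < 3 → A' (3 * j + k) ≡ A (3 * j + k)
        sameB j k j<q k<3 = assign-≢ A S t _ (λ e' → remainder≢bench j k e j<q k<3 e<r (sym e'))
        sameL : ∀ j → j < q → A' (3 * j) ≡ A (3 * j)
        sameL j j<q = assign-≢ A S t _ (λ e' → remainder≢leftmost j e j<q e<r (sym e'))
        sameR : ∀ j → j < q → A' (3 * j + 2) ≡ A (3 * j + 2)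
        sameR j j<q = sameB j 2 j<q 2<3

        counters′ : Counters
        counters′ = counters ℓ ρ c (suc e) k⁺ k⁻ c⁺ (suc c⁻) (seatOf-update seatOf t S)

        invariant′ : Invariant (suc t) A' counters′
        invariant′ = record
          { t≤n = t<n ; ℓ≤q = ℓ≤q ; ρ≤q = ρ≤q ; c≤ℓ = c≤ℓ ; c≤ρ = c≤ρ ; e≤r = e<r
          ; leftmostFilled = λ j j<q → trans (assigned-assign-≢ A S t _ (λ e' → remainder≢leftmost j e j<q e<r (sym e'))) (leftmostFilled j j<q)
          ; centreFilled = λ j j<q → trans (assigned-assign-≢ A S t _ (λ e' → remainder≢bench j 1 e j<q 1<3 e<r (sym e'))) (centreFilled j j<q)
          ; rightmostFilled = λ j j<q → trans (assigned-assign-≢ A S t _ (λ e' → remainder≢bench j 2 e j<q 2<3 e<r (sym e'))) (rightmostFilled j j<q)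
          ; remainderFilled = λ i i<r → assigned-bump A t (3 * q +_) (λ a b → +-cancelˡ-≡ (3 * q) a b) i e (remainderFilled i i<r)
          ; t≡ℓ+ρ+c+e = trans (cong suc t≡ℓ+ρ+c+e) (sym (+-suc (ℓ + ρ + c) e))
          ; plusTally = trans (cong (_+ k⁻) (plusCount-minus t sm)) plusTally
          ; minusTally = trans (cong (_+ k⁺) (minusCount-minus t sm)) (trans (cong suc minusTally) (sym (+-suc (ρ + k⁻) c⁻)))
          ; centreTally = trans (+-suc c e) (trans (cong suc centreTally) (sym (+-suc c⁺ c⁻)))
          ; ℓ<q⇒k⁺≡c⁺≡0 = ℓ<q⇒k⁺≡c⁺≡0
          ; ρ<q⇒k⁻≡c⁻≡0 = λ lt → ⊥-elim (<-irrefl ρ=q lt)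
          ; k⁺≡0⊎k⁻≡0 = k⁺≡0⊎k⁻≡0 ; k⁺-drift = weaken-witness k⁺-drift ; k⁻-drift = weaken-witness k⁻-drift
          ; rightmostMinus = λ lt j j<ρ → SignAt-subst (sameR j (<-≤-trans j<ρ ρ≤q)) (rightmostMinus lt j j<ρ)
          ; leftmostPlus = λ lt → ⊥-elim (<-irrefl ρ=q lt)
          ; noMinusPlusBench = λ j j<ℓ j<ρ m p → noMinusPlusBench j j<ℓ j<ρ (SignAt-subst (sym (sameL j (<-≤-trans j<ℓ ℓ≤q))) m) (SignAt-subst (sym (sameR j (<-≤-trans j<ℓ ℓ≤q))) p)
          ; differingEnds = subst (λ z → ℓ ⊓ ρ ≤ z + k⁺ + k⁻) (sym (ΣN-cong q (λ j j<q → cong ι (endsDiffer-cong A A' j (sameL j j<q) (sameR j j<q))))) differingEnds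
          ; centreLatest = λ j j<c → let j<q = <-≤-trans (<-≤-trans j<c c≤ℓ) ℓ≤q in
                   centreLatest-keep A A' j (sameL j j<q) (sameB j 1 j<q 1<3) (sameR j j<q) (centreLatest j j<c)
          ; seatOf-assigned = seatOf-assigned′ ; seatOf-< = seatOf-<′ ; assigned-seatOf = assigned-seatOf′ }

      module MinusLeft (sm : signOf σ t ≡ minus) (ρ=q : ρ ≡ q) (c=ℓ : c ≡ ℓ) (e=r : e ≡ r) (ℓ<q : ℓ < q) where
        S = 3 * ℓ
        A' = assign A (just S) t
        free : A S ≡ nothing
        free = unassigned⇒nothing A S (trans (leftmostFilled ℓ ℓ<q) (≤→<ᵇ {ℓ} {ℓ} ≤-refl))
        S<n : S < n
        S<n = subst (_< n) (sym (3*j≡3*j+0 ℓ)) (seat<n ℓ 0 ℓ<q (s≤s z≤n))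
        open SeatOfUpdate t A seatOf S free S<n seatOf-assigned seatOf-< assigned-seatOf using (seatOf-assigned′; seatOf-<′; assigned-seatOf′)
        sameC : ∀ j → A' (3 * j + 1) ≡ A (3 * j + 1)
        sameC j = assign-≢ A S t _ (offset≢leftmost j ℓ 1 0<1 1<3)
        sameR : ∀ j → A' (3 * j + 2) ≡ A (3 * j + 2)
        sameR j = assign-≢ A S t _ (offset≢leftmost j ℓ 2 0<2 2<3)
        sameL : ∀ j → j ≢ ℓ → A' (3 * j) ≡ A (3 * j)
        sameL j ne = assign-≢ A S t _ (leftmost-≢ j ℓ ne)

        k⁺≡0 = proj₁ (ℓ<q⇒k⁺≡c⁺≡0 ℓ<q)
        c⁺≡0 = proj₂ (ℓ<q⇒k⁺≡c⁺≡0 ℓ<q)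

        counters′ : Counters
        counters′ = counters (suc ℓ) ρ c e k⁺ (suc k⁻) c⁺ c⁻ (seatOf-update seatOf t S)

        ends : ΣN q (λ j → ι (endsDiffer A j)) + ι (endsDiffer A' ℓ) ≡ ΣN q (λ j → ι (endsDiffer A' j))
        ends = ΣN-update q _ _ ℓ ℓ<q (cong ι (endsDiffer-noLeft A ℓ free)) (λ j _ ne → cong ι (sym (endsDiffer-cong A A' j (sameL j ne) (sameR j))))

        k⁻-drift′ : plusCount σ (suc t) + (q + r) + 2 * suc k⁻ ≤ minusCount σ (suc t) + 1
        k⁻-drift′ = ≤-reflexive (begin
            plusCount σ (suc t) + (q + r) + 2 * suc k⁻ ≡⟨ cong (λ z → z + (q + r) + 2 * suc k⁻) (plusCount-minus t sm) ⟩
            plusCount σ t + (q + r) + 2 * suc k⁻ ≡⟨ overflow-rearrange (plusCount σ t) q r k⁻ ⟩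
            suc (q + k⁻ + (plusCount σ t + k⁻ + r)) + 1 ≡⟨ cong (λ z → suc (q + k⁻ + (z + r)) + 1) plusTally′ ⟩
            suc (q + k⁻ + (ℓ + r)) + 1 ≡⟨ cong (λ z → suc (q + k⁻ + z) + 1) ℓ+r≡c⁻ ⟩
            suc (q + k⁻ + c⁻) + 1 ≡⟨ cong (λ z → suc (z + k⁻ + c⁻) + 1) (sym ρ=q) ⟩
            suc (ρ + k⁻ + c⁻) + 1 ≡⟨ cong (λ z → suc z + 1) (sym minusTally′) ⟩
            suc (minusCount σ t) + 1 ≡⟨ cong (_+ 1) (sym (minusCount-minus t sm)) ⟩
            minusCount σ (suc t) + 1 ∎)
          where
          open ≡-Reasoning
          plusTally′ : plusCount σ t + k⁻ ≡ ℓ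
          plusTally′ = trans plusTally (trans (cong₂ (λ a b → ℓ + a + b) k⁺≡0 c⁺≡0) (trans (+-identityʳ (ℓ + 0)) (+-identityʳ ℓ)))
          minusTally′ : minusCount σ t ≡ ρ + k⁻ + c⁻
          minusTally′ = trans (sym (+-identityʳ (minusCount σ t))) (trans (cong (minusCount σ t +_) (sym k⁺≡0)) minusTally)
          ℓ+r≡c⁻ : ℓ + r ≡ c⁻
          ℓ+r≡c⁻ = trans (cong₂ _+_ (sym c=ℓ) (sym e=r)) (trans centreTally (cong (_+ c⁻) c⁺≡0))

        invariant′ : Invariant (suc t) A' counters′
        invariant′ = record
          { t≤n = t<n ; ℓ≤q = ℓ<q ; ρ≤q = ρ≤q ; c≤ℓ = m≤n⇒m≤1+n c≤ℓ ; c≤ρ = c≤ρ ; e≤r = e≤r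
          ; leftmostFilled = λ j j<q → assigned-bump A t (3 *_) 3*-injective j ℓ (leftmostFilled j j<q)
          ; centreFilled = λ j j<q → trans (assigned-assign-≢ A S t _ (offset≢leftmost j ℓ 1 0<1 1<3)) (centreFilled j j<q)
          ; rightmostFilled = λ j j<q → trans (assigned-assign-≢ A S t _ (offset≢leftmost j ℓ 2 0<2 2<3)) (rightmostFilled j j<q)
          ; remainderFilled = λ i i<r → trans (assigned-assign-≢ A S t _ (remainder≢leftmost ℓ i ℓ<q i<r)) (remainderFilled i i<r)
          ; t≡ℓ+ρ+c+e = cong suc t≡ℓ+ρ+c+e
          ; plusTally = trans (cong (_+ suc k⁻) (plusCount-minus t sm)) (trans (+-suc (plusCount σ t) k⁻) (cong suc plusTally))
          ; minusTally = trans (cong (_+ k⁺) (minusCount-minus t sm)) (trans (cong suc minusTally) (sym (cong (_+ c⁻) (+-suc ρ k⁻))))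
          ; centreTally = centreTally
          ; ℓ<q⇒k⁺≡c⁺≡0 = λ lt → ℓ<q⇒k⁺≡c⁺≡0 (<-trans (n<1+n ℓ) lt)
          ; ρ<q⇒k⁻≡c⁻≡0 = λ lt → ⊥-elim (<-irrefl ρ=q lt)
          ; k⁺≡0⊎k⁻≡0 = inj₁ k⁺≡0 ; k⁺-drift = weaken-witness k⁺-drift ; k⁻-drift = inj₂ (suc t , ≤-refl , k⁻-drift′)
          ; rightmostMinus = λ lt j j<ρ → SignAt-subst (sameR j) (rightmostMinus (<-trans (n<1+n ℓ) lt) j j<ρ)
          ; leftmostPlus = λ lt → ⊥-elim (<-irrefl ρ=q lt)
          ; noMinusPlusBench = noMinusPlusBench′
          ; differingEnds = differingEnds′
          ; centreLatest = λ j j<c → centreLatest-keep A A' j (sameL j (λ e' → <-irrefl (trans e' (sym c=ℓ)) j<c)) (sameC j) (sameR j) (centreLatest j j<c)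
          ; seatOf-assigned = seatOf-assigned′ ; seatOf-< = seatOf-<′ ; assigned-seatOf = assigned-seatOf′ }
          where
          noMinusPlusBench′ : ∀ j → j < suc ℓ → j < ρ → SignAt minus (A' (3 * j)) → SignAt plus (A' (3 * j + 2)) → ⊥
          noMinusPlusBench′ j j<sℓ j<ρ m p with j ≟ ℓ
          ... | yes refl = SignAt-unique (SignAt-subst (sym (sameR j)) p) (rightmostMinus ℓ<q j j<ρ)
          ... | no ne = noMinusPlusBench j (≤∧≢⇒< (≤-pred j<sℓ) ne) j<ρ (SignAt-subst (sym (sameL j ne)) m) (SignAt-subst (sym (sameR j)) p)
          differingEnds′ : suc ℓ ⊓ ρ ≤ ΣN q (λ j → ι (endsDiffer A' j)) + k⁺ + suc k⁻
          differingEnds′ = begin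
            suc ℓ ⊓ ρ ≤⟨ [1+m]⊓n≤1+[m⊓n] ℓ ρ ⟩
            suc (ℓ ⊓ ρ) ≤⟨ s≤s differingEnds ⟩
            suc (ΣN q (λ j → ι (endsDiffer A j)) + k⁺ + k⁻) ≤⟨ s≤s (+-monoˡ-≤ k⁻ (+-monoˡ-≤ k⁺ (≤-trans (m≤m+n _ _) (≤-reflexive ends)))) ⟩
            suc (ΣN q (λ j → ι (endsDiffer A' j)) + k⁺ + k⁻) ≡⟨ sym (+-suc _ k⁻) ⟩
            ΣN q (λ j → ι (endsDiffer A' j)) + k⁺ + suc k⁻ ∎
            where open ≤-Reasoning

      firstFreeLeftmost : ℓ < q → findᵇ (λ j → not (assigned A (3 * j))) (benches n) ≡ just ℓ
      firstFreeLeftmost ℓ<q = findᵇ-first q (λ i → i) _ ℓ ℓ<q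
        (λ i i<ℓ → cong not (trans (leftmostFilled i (<-trans i<ℓ ℓ<q)) (<→<ᵇ i<ℓ)))
        (cong not (trans (leftmostFilled ℓ ℓ<q) (≤→<ᵇ {ℓ} {ℓ} ≤-refl)))
      noFreeLeftmost : ℓ ≡ q → findᵇ (λ j → not (assigned A (3 * j))) (benches n) ≡ nothing
      noFreeLeftmost ℓ=q = findᵇ-none q (λ i → i) _ (λ i i<q → cong not (trans (leftmostFilled i i<q) (<→<ᵇ (subst (i <_) (sym ℓ=q) i<q))))
      firstFreeRightmost : ρ < q → findᵇ (λ j → not (assigned A (3 * j + 2))) (benches n) ≡ just ρ
      firstFreeRightmost ρ<q = findᵇ-first q (λ i → i) _ ρ ρ<q
        (λ i i<ρ → cong not (trans (rightmostFilled i (<-trans i<ρ ρ<q)) (<→<ᵇ i<ρ)))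
        (cong not (trans (rightmostFilled ρ ρ<q) (≤→<ᵇ {ρ} {ρ} ≤-refl)))
      noFreeRightmost : ρ ≡ q → findᵇ (λ j → not (assigned A (3 * j + 2))) (benches n) ≡ nothing
      noFreeRightmost ρ=q = findᵇ-none q (λ i → i) _ (λ i i<q → cong not (trans (rightmostFilled i i<q) (<→<ᵇ (subst (i <_) (sym ρ=q) i<q))))

      primed-val : ∀ j → j < q → primed A j ≡ ((j <ᵇ ℓ) ∧ ((j <ᵇ ρ) ∧ not (j <ᵇ c)))
      primed-val j lt = cong₂ _∧_ (leftmostFilled j lt) (cong₂ _∧_ (rightmostFilled j lt) (cong not (centreFilled j lt)))

      ¬primed-below-c : ∀ i → i < c → primed A i ≡ false
      ¬primed-below-c i i<c = trans (primed-val i (<-≤-trans i<c (≤-trans c≤ℓ ℓ≤q)))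
        (trans (cong (λ z → (i <ᵇ ℓ) ∧ ((i <ᵇ ρ) ∧ not z)) (<→<ᵇ i<c)) (trans (cong ((i <ᵇ ℓ) ∧_) (∧-zeroʳ (i <ᵇ ρ))) (∧-zeroʳ (i <ᵇ ℓ))))

      firstPrimed : c < ℓ → c < ρ → findᵇ (primed A) (benches n) ≡ just c
      firstPrimed c<ℓ c<ρ = findᵇ-first q (λ i → i) (primed A) c (<-≤-trans c<ℓ ℓ≤q) ¬primed-below-c
        (trans (primed-val c (<-≤-trans c<ℓ ℓ≤q)) (trans (cong₂ (λ a b → a ∧ (b ∧ not (c <ᵇ c))) (<→<ᵇ c<ℓ) (<→<ᵇ c<ρ))
          (cong (λ z → true ∧ (true ∧ not z)) (≤→<ᵇ {c} {c} ≤-refl))))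

      noPrimed : (c ≡ ℓ) ⊎ (c ≡ ρ) → findᵇ (primed A) (benches n) ≡ nothing
      noPrimed h = findᵇ-none q (λ i → i) (primed A) (pn h)
        where
        pn : (c ≡ ℓ) ⊎ (c ≡ ρ) → ∀ i → i < q → primed A i ≡ false
        pn h' i i<q with i <? c
        ... | yes i<c = ¬primed-below-c i i<c
        pn (inj₁ c=ℓ) i i<q | no ¬i<c = trans (primed-val i i<q) (cong (λ z → z ∧ ((i <ᵇ ρ) ∧ not (i <ᵇ c))) (≤→<ᵇ (subst (_≤ i) c=ℓ (≮⇒≥ ¬i<c))))
        pn (inj₂ c=ρ) i i<q | no ¬i<c = trans (primed-val i i<q) (trans (cong (λ z → (i <ᵇ ℓ) ∧ (z ∧ not (i <ᵇ c))) (≤→<ᵇ (subst (_≤ i) c=ρ (≮⇒≥ ¬i<c)))) (∧-zeroʳ (i <ᵇ ℓ)))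

      remainderSeats≡ : remainderSeats n ≡ applyUpTo (λ i → 3 * q + i) r
      remainderSeats≡ = map-applyUpTo (λ i → 3 * q + i) (λ i → i) r

      firstFreeRemainder : e < r → findᵇ (λ s → not (assigned A s)) (remainderSeats n) ≡ just (3 * q + e)
      firstFreeRemainder e<r = trans (cong (findᵇ (λ s → not (assigned A s))) remainderSeats≡)
        (findᵇ-first r (λ i → 3 * q + i) _ e e<r
          (λ i i<e → cong not (trans (remainderFilled i (<-trans i<e e<r)) (<→<ᵇ i<e)))
          (cong not (trans (remainderFilled e e<r) (≤→<ᵇ {e} {e} ≤-refl))))
      noFreeRemainder : e ≡ r → findᵇ (λ s → not (assigned A s)) (remainderSeats n) ≡ nothing
      noFreeRemainder e=r = trans (cong (findᵇ (λ s → not (assigned A s))) remainderSeats≡)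
        (findᵇ-none r (λ i → 3 * q + i) _ (λ i i<r → cong not (trans (remainderFilled i i<r) (<→<ᵇ (subst (i <_) (sym e=r) i<r)))))

      open ChooseSeat n A using (choose-plus-left; choose-plus-primed; choose-plus-right; choose-minus-right; choose-minus-primed; choose-minus-left; primedSeat-bench; primedSeat-remainder)

      notAllFull : ℓ ≡ q → ρ ≡ q → c ≡ q → e ≡ r → ⊥
      notAllFull a b c' d = <-irrefl (trans t≡ℓ+ρ+c+e (trans (cong₂ (λ x y → x + y + c + e) a b) (trans (cong₂ (λ x y → q + q + x + y) c' d) (sym n≡q+q+q+r)))) t<n

      Next : Sign → Set
      Next s = Σ Counters (λ counters′ → Invariant (suc t) (assign A (chooseSeat n A s) t) counters′)

      next-by : ∀ s {m} → chooseSeat n A s ≡ m → Σ Counters (λ counters′ → Invariant (suc t) (assign A m t) counters′) → Next s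
      next-by s e r' = subst (λ m → Σ Counters (λ counters′ → Invariant (suc t) (assign A m t) counters′)) (sym e) r'

      stepPlus : signOf σ t ≡ plus → Next plus
      stepPlus sp with ℓ <? q
      ... | yes ℓ<q = next-by plus (choose-plus-left ℓ (firstFreeLeftmost ℓ<q)) (PlusLeft.counters′ sp ℓ<q , PlusLeft.invariant′ sp ℓ<q)
      ... | no ¬ℓ<q = plus-leftmostFull (≤-antisym ℓ≤q (≮⇒≥ ¬ℓ<q))
        where
        plus-leftmostFull : ℓ ≡ q → Next plus
        plus-leftmostFull ℓ=q with c <? ρ
        ... | yes c<ρ = next-by plus (choose-plus-primed (3 * c + 1) (noFreeLeftmost ℓ=q) (primedSeat-bench c (firstPrimed (subst (c <_) (sym ℓ=q) (<-≤-trans c<ρ ρ≤q)) c<ρ)))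
                           (PlusCentre.counters′ sp ℓ=q c<ρ , PlusCentre.invariant′ sp ℓ=q c<ρ)
        ... | no ¬c<ρ = plus-noPrimedBench (≤-antisym c≤ρ (≮⇒≥ ¬c<ρ))
          where
          plus-noPrimedBench : c ≡ ρ → Next plus
          plus-noPrimedBench c=ρ with e <? r
          ... | yes e<r = next-by plus (choose-plus-primed (3 * q + e) (noFreeLeftmost ℓ=q) (trans (primedSeat-remainder (noPrimed (inj₂ c=ρ))) (firstFreeRemainder e<r)))
                             (PlusRemainder.counters′ sp ℓ=q c=ρ e<r , PlusRemainder.invariant′ sp ℓ=q c=ρ e<r)
          ... | no ¬e<r = plus-remainderFull (≤-antisym e≤r (≮⇒≥ ¬e<r))
            where
            plus-remainderFull : e ≡ r → Next plus
            plus-remainderFull e=r with ρ <? q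
            ... | yes ρ<q = next-by plus (choose-plus-right ρ (noFreeLeftmost ℓ=q) (trans (primedSeat-remainder (noPrimed (inj₂ c=ρ))) (noFreeRemainder e=r)) (firstFreeRightmost ρ<q))
                               (PlusRight.counters′ sp ℓ=q c=ρ e=r ρ<q , PlusRight.invariant′ sp ℓ=q c=ρ e=r ρ<q)
            ... | no ¬ρ<q = ⊥-elim (notAllFull ℓ=q ρ=q (trans c=ρ ρ=q) e=r)
              where ρ=q = ≤-antisym ρ≤q (≮⇒≥ ¬ρ<q)

      stepMinus : signOf σ t ≡ minus → Next minus
      stepMinus sm with ρ <? q
      ... | yes ρ<q = next-by minus (choose-minus-right ρ (firstFreeRightmost ρ<q)) (MinusRight.counters′ sm ρ<q , MinusRight.invariant′ sm ρ<q)
      ... | no ¬ρ<q = minus-rightmostFull (≤-antisym ρ≤q (≮⇒≥ ¬ρ<q))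
        where
        minus-rightmostFull : ρ ≡ q → Next minus
        minus-rightmostFull ρ=q with c <? ℓ
        ... | yes c<ℓ = next-by minus (choose-minus-primed (3 * c + 1) (noFreeRightmost ρ=q) (primedSeat-bench c (firstPrimed c<ℓ (subst (c <_) (sym ρ=q) (<-≤-trans c<ℓ ℓ≤q)))))
                           (MinusCentre.counters′ sm ρ=q c<ℓ , MinusCentre.invariant′ sm ρ=q c<ℓ)
        ... | no ¬c<ℓ = minus-noPrimedBench (≤-antisym c≤ℓ (≮⇒≥ ¬c<ℓ))
          where
          minus-noPrimedBench : c ≡ ℓ → Next minus
          minus-noPrimedBench c=ℓ with e <? r
          ... | yes e<r = next-by minus (choose-minus-primed (3 * q + e) (noFreeRightmost ρ=q) (trans (primedSeat-remainder (noPrimed (inj₁ c=ℓ))) (firstFreeRemainder e<r)))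
                             (MinusRemainder.counters′ sm ρ=q c=ℓ e<r , MinusRemainder.invariant′ sm ρ=q c=ℓ e<r)
          ... | no ¬e<r = minus-remainderFull (≤-antisym e≤r (≮⇒≥ ¬e<r))
            where
            minus-remainderFull : e ≡ r → Next minus
            minus-remainderFull e=r with ℓ <? q
            ... | yes ℓ<q = next-by minus (choose-minus-left ℓ (noFreeRightmost ρ=q) (trans (primedSeat-remainder (noPrimed (inj₁ c=ℓ))) (noFreeRemainder e=r)) (firstFreeLeftmost ℓ<q))
                               (MinusLeft.counters′ sm ρ=q c=ℓ e=r ℓ<q , MinusLeft.invariant′ sm ρ=q c=ℓ e=r ℓ<q)
            ... | no ¬ℓ<q = ⊥-elim (notAllFull ℓ=q ρ=q (trans c=ℓ ℓ=q) e=r)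
              where ℓ=q = ≤-antisym ℓ≤q (≮⇒≥ ¬ℓ<q)

      step : Next (signOf σ t)
      step with signOf σ t in es
      ... | plus = stepPlus es
      ... | minus = stepMinus es

    open Drift using (nth; signOf-nth; prefix≤drift; prefix≤drift-negσ)

    runC-invariant : ∀ ss t A G → Invariant t A G → t + Data.List.length ss ≡ n →
              (∀ j → j < Data.List.length ss → nth ss j ≡ signOf σ (t + j)) →
              Σ Counters (λ counters′ → Invariant n (runC n t ss A) counters′)
    runC-invariant [] t A G I e _ = G , subst (λ z → Invariant z A G) (trans (sym (+-identityʳ t)) e) I
    runC-invariant (s ∷ ss) t A G I e h =
      let t<n : t < n
          t<n = subst (t <_) e (≤-trans (s≤s (m≤m+n t (Data.List.length ss))) (≤-reflexive (sym (+-suc t _))))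
          hs : s ≡ signOf σ t
          hs = trans (h 0 (s≤s z≤n)) (cong (signOf σ) (+-identityʳ t))
          r' = Step.step t A G I t<n
          counters′ = proj₁ r'
          I' = subst (λ s' → Invariant (suc t) (assign A (chooseSeat n A s') t) counters′) (sym hs) (proj₂ r')
      in runC-invariant ss (suc t) _ counters′ I' (trans (sym (+-suc t _)) e)
           (λ j lt → trans (h (suc j) (s≤s lt)) (cong (signOf σ) (+-suc t j)))

    βC-invariant : Σ Counters (λ G → Invariant n (βC σ) G)
    βC-invariant = runC-invariant (toList σ) 0 (λ _ → nothing) counters₀ invariant₀ (length-toList σ) (λ j _ → sym (signOf-nth σ j))

    +-≤-equal₄ : ∀ {a b c d x y z w} → a ≤ x → b ≤ y → c ≤ z → d ≤ w → a + b + c + d ≡ x + y + z + w →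
          a ≡ x × b ≡ y × c ≡ z × d ≡ w
    +-≤-equal₄ {a} {b} {c} {d} {x} {y} {z} {w} ax by cz dw e =
        ≤-antisym ax (≮⇒≥ (λ lt → <-irrefl e (+-mono-<-≤ (+-mono-<-≤ (+-mono-<-≤ lt by) cz) dw))) ,
        ≤-antisym by (≮⇒≥ (λ lt → <-irrefl e (+-mono-<-≤ (+-mono-<-≤ (+-mono-≤-< ax lt) cz) dw))) ,
        ≤-antisym cz (≮⇒≥ (λ lt → <-irrefl e (+-mono-<-≤ (+-mono-≤-< (+-mono-≤ ax by) lt) dw))) ,
        ≤-antisym dw (≮⇒≥ (λ lt → <-irrefl e (+-mono-≤-< (+-mono-≤ (+-mono-≤ ax by) cz) lt)))

    balancedᵇ-val : ∀ A j a x b → A (3 * j) ≡ just a → A (3 * j + 1) ≡ just x → A (3 * j + 2) ≡ just b → a < x → b < x →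
               balancedᵇ σ A j ≡ differ (signOf σ a) (signOf σ b)
    balancedᵇ-val A j a x b e1 e2 e3 lt1 lt2 with A (3 * j) | A (3 * j + 1) | A (3 * j + 2)
    balancedᵇ-val A j a x b refl refl refl lt1 lt2 | _ | _ | _
      rewrite <→≤ᵇ lt1 | ≤→≤ᵇ (<⇒≤ lt2) = refl

    module Terminal (G : Counters) (I : Invariant n (βC σ) G) where
      open Counters G
      open Invariant I
      A = βC σ

      allFull = +-≤-equal₄ {ℓ} {ρ} {c} {e} {q} {q} {q} {r} ℓ≤q ρ≤q (≤-trans c≤ℓ ℓ≤q) e≤r (trans (sym t≡ℓ+ρ+c+e) n≡q+q+q+r)
      ℓ=q = proj₁ allFull
      ρ=q = proj₁ (proj₂ allFull)
      c=q = proj₁ (proj₂ (proj₂ allFull))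
      e=r = proj₂ (proj₂ (proj₂ allFull))

      βC-complete : ∀ s → s < n → Σ ℕ (λ u → A s ≡ just u)
      βC-complete s s<n with seat-decompose s s<n
      ... | inj₂ (i , i<r , refl) = assigned⇒just A _ (trans (remainderFilled i i<r) (<→<ᵇ (subst (i <_) (sym e=r) i<r)))
      ... | inj₁ (j , 0 , j<q , _ , refl) =
            assigned⇒just A _ (trans (cong (assigned A) (sym (3*j≡3*j+0 j))) (trans (leftmostFilled j j<q) (<→<ᵇ (subst (j <_) (sym ℓ=q) j<q))))
      ... | inj₁ (j , 1 , j<q , _ , refl) = assigned⇒just A _ (trans (centreFilled j j<q) (<→<ᵇ (subst (j <_) (sym c=q) j<q)))
      ... | inj₁ (j , 2 , j<q , _ , refl) = assigned⇒just A _ (trans (rightmostFilled j j<q) (<→<ᵇ (subst (j <_) (sym ρ=q) j<q)))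
      ... | inj₁ (j , suc (suc (suc k)) , j<q , s≤s (s≤s (s≤s ())) , _)

      dinerIn : ℕ → ℕ
      dinerIn s with A s
      ... | just u = u
      ... | nothing = 0

      dinerIn-just : ∀ s u → A s ≡ just u → dinerIn s ≡ u
      dinerIn-just s u e with A s
      dinerIn-just s u refl | just .u = refl

      dinerIn-seatOf : ∀ u → u < n → dinerIn (seatOf u) ≡ u
      dinerIn-seatOf u lt = dinerIn-just (seatOf u) u (seatOf-assigned u lt)

      seatOf-dinerIn : ∀ s → s < n → seatOf (dinerIn s) ≡ s
      seatOf-dinerIn s lt with βC-complete s lt
      ... | (u , e) rewrite dinerIn-just s u e = proj₂ (assigned-seatOf s u e)

      dinerIn-< : ∀ s → s < n → dinerIn s < n
      dinerIn-< s lt with βC-complete s lt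
      ... | (u , e) rewrite dinerIn-just s u e = proj₁ (assigned-seatOf s u e)

      centreLatestAll : ∀ j → j < q → Σ ℕ λ a → Σ ℕ λ x → Σ ℕ λ b →
                A (3 * j) ≡ just a × A (3 * j + 1) ≡ just x × A (3 * j + 2) ≡ just b × a < x × b < x
      centreLatestAll j j<q = centreLatest j (subst (j <_) (sym c=q) j<q)

      balanced≡endsDiffer : ∀ j → j < q → balancedᵇ σ A j ≡ endsDiffer A j
      balanced≡endsDiffer j j<q with centreLatestAll j j<q
      ... | (a , x , b , e1 , e2 , e3 , l1 , l2) = trans (balancedᵇ-val A j a x b e1 e2 e3 l1 l2) (sym (endsDiffer-val A j a b e1 e3))

      b≡ΣN-endsDiffer : b σ A ≡ ΣN q (λ j → ι (endsDiffer A j))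
      b≡ΣN-endsDiffer = trans (count-applyUpTo (balancedᵇ σ A) (λ i → i) q) (ΣN-cong q (λ j j<q → cong ι (balanced≡endsDiffer j j<q)))

      q≤b+k⁺+k⁻ : q ≤ b σ A + k⁺ + k⁻
      q≤b+k⁺+k⁻ = subst₂ (λ u v → u ≤ v + k⁺ + k⁻) (trans (cong₂ _⊓_ ℓ=q ρ=q) (⊓-idem q)) (sym b≡ΣN-endsDiffer) differingEnds

      k⁺-bound : k⁺ ≡ 0 ⊎ (q + r) + 2 * k⁺ ≤ drift σ + 1
      k⁺-bound with k⁺-drift
      ... | inj₁ z = inj₁ z
      ... | inj₂ (k , k≤n , le) = inj₂ (+-cancelˡ-≤ (minusCount σ k) _ _ (begin
            minusCount σ k + (q + r + 2 * k⁺) ≡⟨ sym (+-assoc (minusCount σ k) _ _) ⟩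
            minusCount σ k + (q + r) + 2 * k⁺ ≤⟨ le ⟩
            plusCount σ k + 1 ≤⟨ +-monoˡ-≤ 1 (prefix≤drift σ k k≤n) ⟩
            drift σ + minusCount σ k + 1 ≡⟨ cong (_+ 1) (+-comm (drift σ) (minusCount σ k)) ⟩
            minusCount σ k + drift σ + 1 ≡⟨ +-assoc (minusCount σ k) _ _ ⟩
            minusCount σ k + (drift σ + 1) ∎))
        where open ≤-Reasoning

      k⁻-bound : k⁻ ≡ 0 ⊎ (q + r) + 2 * k⁻ ≤ drift (negσ σ) + 1
      k⁻-bound with k⁻-drift
      ... | inj₁ z = inj₁ z
      ... | inj₂ (k , k≤n , le) = inj₂ (+-cancelˡ-≤ (plusCount σ k) _ _ (begin
            plusCount σ k + (q + r + 2 * k⁻) ≡⟨ sym (+-assoc (plusCount σ k) _ _) ⟩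
            plusCount σ k + (q + r) + 2 * k⁻ ≤⟨ le ⟩
            minusCount σ k + 1 ≤⟨ +-monoˡ-≤ 1 (prefix≤drift-negσ σ k k≤n) ⟩
            drift (negσ σ) + plusCount σ k + 1 ≡⟨ cong (_+ 1) (+-comm (drift (negσ σ)) (plusCount σ k)) ⟩
            plusCount σ k + drift (negσ σ) + 1 ≡⟨ +-assoc (plusCount σ k) _ _ ⟩
            plusCount σ k + (drift (negσ σ) + 1) ∎))
        where open ≤-Reasoning


module HalfArithmetic where

  open import Data.Nat
  open import Data.Nat.Properties
  open import Data.Nat.DivMod using (/-monoˡ-≤; m*n/n≡m)
  open import Relation.Binary.PropositionalEquality
  open import Data.Nat.Tactic.RingSolver using (solve-∀)

  x≤1+2B⇒⌊x/2⌋≤B : ∀ x B → x ≤ suc (2 * B) → ⌊ x /2⌋ ≤ B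
  x≤1+2B⇒⌊x/2⌋≤B x B le =
    subst (⌊ x /2⌋ ≤_) (sym (n≡⌈n+n/2⌉ B)) (⌊n/2⌋-mono (subst (λ z → x ≤ suc z) (cong (B +_) (+-identityʳ B)) le))

  2v≤x⇒v≤⌊x/2⌋ : ∀ v x → 2 * v ≤ x → v ≤ ⌊ x /2⌋
  2v≤x⇒v≤⌊x/2⌋ v x le = subst (_≤ ⌊ x /2⌋) (sym (n≡⌊n+n/2⌋ v)) (⌊n/2⌋-mono (subst (_≤ x) (cong (v +_) (+-identityʳ v)) le))

  3a≤n⇒a≤n/3 : ∀ a n → 3 * a ≤ n → a ≤ n / 3
  3a≤n⇒a≤n/3 a n le = subst (_≤ n / 3) (trans (cong (_/ 3) (*-comm 3 a)) (m*n/n≡m a 3)) (/-monoˡ-≤ 3 le)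

  half-bound : ∀ n q r B k h′ h → n ≡ 3 * q + r → q ≤ B + k → q + r + 2 * k ≤ h′ + 1 → h′ ≤ h → ⌊ n ∸ h /2⌋ ≤ B
  half-bound n q r B k h′ h n≡ q≤B+k overflow h′≤h = x≤1+2B⇒⌊x/2⌋≤B (n ∸ h) B (m≤n+o⇒m∸n≤o n h n≤h+1+2B)
    where
    regroup₁ : ∀ q r k → 3 * q + r + 2 * k ≡ (q + r + 2 * k) + 2 * q
    regroup₁ = solve-∀
    regroup₂ : ∀ h′ B k → (h′ + 1) + 2 * (B + k) ≡ (h′ + suc (2 * B)) + 2 * k
    regroup₂ = solve-∀
    n+2k≤ : n + 2 * k ≤ (h′ + suc (2 * B)) + 2 * k
    n+2k≤ = begin
       n + 2 * k               ≡⟨ cong (_+ 2 * k) n≡ ⟩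
       3 * q + r + 2 * k       ≡⟨ regroup₁ q r k ⟩
       (q + r + 2 * k) + 2 * q ≤⟨ +-mono-≤ overflow (*-monoʳ-≤ 2 q≤B+k) ⟩
       (h′ + 1) + 2 * (B + k)  ≡⟨ regroup₂ h′ B k ⟩
       (h′ + suc (2 * B)) + 2 * k ∎
      where open ≤-Reasoning
    n≤h+1+2B : n ≤ h + suc (2 * B)
    n≤h+1+2B = ≤-trans (+-cancelʳ-≤ (2 * k) n _ n+2k≤) (+-monoˡ-≤ (suc (2 * B)) h′≤h)


open import Data.Nat
open import Data.Nat.Properties using (≤-antisym; ≤-trans)
open import Data.Vec using (Vec)
open import Data.Product using (_×_; _,_)
import Data.Fin.Permutation as Permutation
open import Relation.Binary.PropositionalEquality using (_≡_; refl)
open import Defs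

module Optimality (n₁ : ℕ) (σ : Vec Sign (suc (suc n₁))) where

  open import Data.Bool using (true; false)
  open import Data.Nat.Properties
  open import Data.Nat.GeneralisedArithmetic using (iterate)
  open import Data.Fin.Permutation using (Permutation′)
  open import Data.Product using (_×_; _,_; proj₁; proj₂)
  open import Data.Sum using (inj₁; inj₂)
  open import Data.Empty using (⊥-elim)
  open import Data.Maybe using (just)
  open import Relation.Binary.PropositionalEquality
  open import Data.Nat.Tactic.RingSolver using (solve-∀)
  open Sums
  open Cyclic
  open Signs
  open Drift using (drift≤; drift-negσ≤)
  open HalfArithmetic

  N : ℕ
  N = suc (suc n₁)

  module T = AlgorithmC.Trace N σ
  open T using (q; r; n-eq; 3q≤n; Counters; Invariant; βC-invariant; balancedᵇ-val)
  open CyclicOrder (suc n₁) using (predN; succN; predN-<; succN-<; predN-succN; succN-predN; succN-suc)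
  open Rotation (suc n₁)

  h : ℕ
  h = drift σ ⊔ drift (negσ σ)

  bound : ℕ
  bound = q ⊓ ⌊ N ∸ h /2⌋

  ν≤bound : ∀ (w : Permutation′ N) → ν w σ ≤ bound
  ν≤bound w = ⊓-glb (3a≤n⇒a≤n/3 (ν w σ) N R.3ν≤n) ν≤half
    where
    module R = Napkins.Run n₁ w σ
    regroup : ∀ a b c → a + b + c ≡ a + c + b
    regroup = solve-∀
    2ν≤N : 2 * ν w σ ≤ N
    2ν≤N = +-cancelʳ-≤ 0 _ _ (subst (_≤ N + 0) (+-comm 0 (2 * ν w σ)) (R.prefix-bound-plus 0 z≤n))
    slack = N ∸ 2 * ν w σ
    N≡ : N ≡ slack + 2 * ν w σ
    N≡ = sym (m∸n+n≡m 2ν≤N)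
    plus-slack : ∀ k → k ≤ N → plusCount σ k ≤ slack + minusCount σ k
    plus-slack k le = +-cancelʳ-≤ (2 * ν w σ) _ _
      (≤-trans (R.prefix-bound-plus k le) (≤-reflexive (trans (cong (_+ minusCount σ k) N≡) (regroup slack _ _))))
    minus-slack : ∀ k → k ≤ N → minusCount σ k ≤ slack + plusCount σ k
    minus-slack k le = +-cancelʳ-≤ (2 * ν w σ) _ _
      (≤-trans (R.prefix-bound-minus k le) (≤-reflexive (trans (cong (_+ plusCount σ k) N≡) (regroup slack _ _))))
    h≤slack : h ≤ slack
    h≤slack = ⊔-lub (drift≤ σ slack plus-slack) (drift-negσ≤ σ slack minus-slack)
    ν≤half : ν w σ ≤ ⌊ N ∸ h /2⌋
    ν≤half = 2v≤x⇒v≤⌊x/2⌋ (ν w σ) (N ∸ h)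
      (≤-trans (≤-reflexive (sym (trans (cong (_∸ slack) N≡) (m+n∸m≡n slack _)))) (∸-monoʳ-≤ N h≤slack))

  G : Counters
  G = proj₁ βC-invariant

  I : Invariant N (βC σ) G
  I = proj₂ βC-invariant

  module F = T.Terminal G I
  open Invariant I
  open Counters G using (k⁺; k⁻; seatOf)
  open F using (dinerIn; dinerIn-just; dinerIn-<; dinerIn-seatOf; seatOf-dinerIn)

  A : Arrangement
  A = βC σ

  q≤b+k⁻ : k⁺ ≡ 0 → q ≤ b σ A + k⁻
  q≤b+k⁻ k⁺≡0 = ≤-trans F.q≤b+k⁺+k⁻ (≤-reflexive (cong (_+ k⁻) (trans (cong (b σ A +_) k⁺≡0) (+-identityʳ _))))

  q≤b+k⁺ : k⁻ ≡ 0 → q ≤ b σ A + k⁺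
  q≤b+k⁺ k⁻≡0 = ≤-trans F.q≤b+k⁺+k⁻ (≤-reflexive (trans (cong (b σ A + k⁺ +_) k⁻≡0) (+-identityʳ _)))

  q≤b : k⁺ ≡ 0 → k⁻ ≡ 0 → q ≤ b σ A
  q≤b k⁺≡0 k⁻≡0 = ≤-trans (q≤b+k⁺ k⁻≡0) (≤-reflexive (trans (cong (b σ A +_) k⁺≡0) (+-identityʳ _)))

  bound≤b : bound ≤ b σ A
  bound≤b with k⁺≡0⊎k⁻≡0 | F.k⁺-bound | F.k⁻-bound
  ... | inj₁ k⁺≡0 | _ | inj₁ k⁻≡0 = ≤-trans (m⊓n≤m q _) (q≤b k⁺≡0 k⁻≡0)
  ... | inj₁ k⁺≡0 | _ | inj₂ overflow =
        ≤-trans (m⊓n≤n q _) (half-bound N q r (b σ A) k⁻ _ h n-eq (q≤b+k⁻ k⁺≡0) overflow (m≤n⊔m _ _))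
  ... | inj₂ k⁻≡0 | inj₁ k⁺≡0 | _ = ≤-trans (m⊓n≤m q _) (q≤b k⁺≡0 k⁻≡0)
  ... | inj₂ k⁻≡0 | inj₂ overflow | _ =
        ≤-trans (m⊓n≤n q _) (half-bound N q r (b σ A) k⁺ _ h n-eq (q≤b+k⁺ k⁻≡0) overflow (m≤m⊔n _ _))

  -- wC seats Diner u at βC's seat for u, rotated back by d = seatOf 0 so that Diner 0 is in Seat 0.
  d : ℕ
  d = seatOf 0

  rotate unrotate : ℕ → ℕ
  rotate s = iterate predN s d
  unrotate s = iterate succN s d

  seatC dinerC : ℕ → ℕ
  seatC u = rotate (seatOf u)
  dinerC s = dinerIn (unrotate s)

  seatC-< : ∀ u → u < N → seatC u < N
  seatC-< u lt = iterate-< predN predN-< d (seatOf u) (seatOf-< u lt)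

  dinerC-< : ∀ s → s < N → dinerC s < N
  dinerC-< s lt = dinerIn-< (unrotate s) (iterate-< succN succN-< d s lt)

  dinerC-seatC : ∀ u → u < N → dinerC (seatC u) ≡ u
  dinerC-seatC u lt =
    trans (cong dinerIn (iterate-inverse predN succN predN-< succN-predN d (seatOf u) (seatOf-< u lt))) (dinerIn-seatOf u lt)

  seatC-dinerC : ∀ s → s < N → seatC (dinerC s) ≡ s
  seatC-dinerC s lt =
    trans (cong rotate (seatOf-dinerIn (unrotate s) (iterate-< succN succN-< d s lt))) (iterate-inverse succN predN succN-< predN-succN d s lt)

  module W = PermutationFrom (suc n₁) seatC dinerC seatC-< dinerC-< dinerC-seatC seatC-dinerC

  wC : Permutation′ N
  wC = W.perm

  wC-seatingOrder : IsSeatingOrder wC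
  wC-seatingOrder i e =
    trans (W.toℕ-toF i) (trans (cong dinerC e) (trans (cong dinerIn (iterate-succN-0 d (seatOf-< 0 (s≤s z≤n)))) (dinerIn-seatOf 0 (s≤s z≤n))))

  module R = Napkins.Run n₁ wC σ

  seat≡seatC : ∀ t → t < N → R.seat t ≡ seatC t
  seat≡seatC t lt = trans (W.toℕ-fromF (R.fin t)) (cong seatC (toℕ-clamp (suc n₁) t (≤-pred lt)))

  balanced⇒plus-minus : ∀ j → j < q → ∀ a b → A (3 * j) ≡ just a → A (3 * j + 2) ≡ just b →
                        differ (signOf σ a) (signOf σ b) ≡ true → signOf σ a ≡ plus × signOf σ b ≡ minus
  balanced⇒plus-minus j j<q a b Aa Ab dif with signOf σ a in ea | signOf σ b in eb | dif
  ... | plus | minus | _ = refl , refl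
  ... | plus | plus | ()
  ... | minus | minus | ()
  ... | minus | plus | _ = ⊥-elim (noMinusPlusBench j (subst (j <_) (sym F.ℓ=q) j<q) (subst (j <_) (sym F.ρ=q) j<q)
                                    (T.SignAt-subst Aa ea) (T.SignAt-subst Ab eb))

  balanced⇒centre-napkinless : ∀ j → j < q → balancedᵇ σ A j ≡ true → R.napkinless (dinerIn (3 * j + 1)) ≡ true
  balanced⇒centre-napkinless j j<q bal with F.centreLatestAll j j<q
  ... | (a , x , b′ , Aa , Ax , Ab , a<x , b<x) = subst (λ z → R.napkinless z ≡ true) (sym (dinerIn-just _ x Ax))
        (R.napkinless-centre a x b′ a<N x<N b<N seat-a seat-b
           (trans (R.sgn-signOf a a<N) (proj₁ signs)) (trans (R.sgn-signOf b′ b<N) (proj₂ signs)) a<x b<x)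
    where
    a<N = proj₁ (assigned-seatOf _ a Aa)
    x<N = proj₁ (assigned-seatOf _ x Ax)
    b<N = proj₁ (assigned-seatOf _ b′ Ab)
    seat-x : R.seat x ≡ rotate (3 * j + 1)
    seat-x = trans (seat≡seatC x x<N) (cong rotate (proj₂ (assigned-seatOf _ x Ax)))
    seat-a : R.seat a ≡ predN (R.seat x)
    seat-a = trans (seat≡seatC a a<N) (trans (cong rotate (proj₂ (assigned-seatOf _ a Aa)))
               (trans (cong rotate (cong predN (+-comm 1 (3 * j)))) (trans (iterate-comm predN (3 * j + 1) d) (cong predN (sym seat-x)))))
    3j+2<N : suc (3 * j + 1) < N
    3j+2<N = subst (_< N) (+-suc (3 * j) 1) (T.seat<n j 2 j<q T.2<3)
    seat-b : R.seat b′ ≡ succN (R.seat x)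
    seat-b = trans (seat≡seatC b′ b<N) (trans (cong rotate (proj₂ (assigned-seatOf _ b′ Ab)))
               (trans (cong rotate (sym (trans (succN-suc (3 * j + 1) 3j+2<N) (sym (+-suc (3 * j) 1)))))
                 (trans (iterate-predN-succN d (3 * j + 1) (<-trans (n<1+n _) 3j+2<N)) (cong succN (sym seat-x)))))
    signs = balanced⇒plus-minus j j<q a b′ Aa Ab (trans (sym (balancedᵇ-val A j a x b′ Aa Ax Ab a<x b<x)) bal)

  b≤ν-wC : b σ A ≤ ν wC σ
  b≤ν-wC = begin
      b σ A                                                         ≡⟨ count-applyUpTo (balancedᵇ σ A) (λ i → i) q ⟩
      ΣN q (λ j → ι (balancedᵇ σ A j))                              ≤⟨ ΣN-mono q balanced≤centre ⟩
      ΣN q (λ j → X (3 * j + 1))                                    ≤⟨ ΣN-mono q (λ j _ → ≤-trans (m≤n+m _ (X (3 * j))) (m≤m+n _ (X (3 * j + 2)))) ⟩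
      ΣN q (λ j → X (3 * j) + X (3 * j + 1) + X (3 * j + 2))        ≡⟨ sym (ΣN-triples q X) ⟩
      ΣN (3 * q) X                                                  ≤⟨ ΣN-monoˡ X 3q≤n ⟩
      ΣN N X                                                        ≡⟨ BySeatOf.ΣN-reindex (λ t → ι (R.napkinless t)) ⟩
      ΣN N (λ t → ι (R.napkinless t))                               ≡⟨ sym R.ν-count ⟩
      ν wC σ                                                        ∎
    where
    open ≤-Reasoning
    module BySeatOf = PermutationFrom (suc n₁) seatOf dinerIn seatOf-< dinerIn-< dinerIn-seatOf seatOf-dinerIn
    X : ℕ → ℕ
    X s = ι (R.napkinless (dinerIn s))
    balanced≤centre : ∀ j → j < q → ι (balancedᵇ σ A j) ≤ X (3 * j + 1)
    balanced≤centre j j<q with balancedᵇ σ A j in eb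
    ... | false = z≤n
    ... | true = ≤-reflexive (cong ι (sym (balanced⇒centre-napkinless j j<q eb)))


corollary5p5 : (n : ℕ) → 1 ≤ n → (σ : Vec Sign n) →
    IsνMax σ (b σ (βC σ))
    × b σ (βC σ) ≡ (n / 3) ⊓ ⌊ n ∸ (drift σ ⊔ drift (negσ σ)) /2⌋
corollary5p5 (suc zero) _ σ = ((Permutation.id , (λ _ e → e) , refl) , (λ _ _ → z≤n)) , refl
corollary5p5 (suc (suc n₁)) _ σ =
  ((wC , wC-seatingOrder , ≤-antisym (≤-trans (ν≤bound wC) bound≤b) b≤ν-wC) , λ w _ → ≤-trans (ν≤bound w) bound≤b) ,
  ≤-antisym (≤-trans b≤ν-wC (ν≤bound wC)) bound≤b
  where open Optimality n₁ σ
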